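{- Let $n\ge 1$ be a fixed integer. Then the map $P\mapsto \mathrm{CE}(P;n)$, defined on lattice polytopes in $\mathbb{R}^d$, is a lattice-invariant valuation.
   Context: Lattice polytopes are convex polytopes with vertices in $\mathbb{Z}^d$. $\mathrm{CE}(P;n) = |\{a\in nP\cap\mathbb{Z}^d : \gcd(a_1,\dots,a_d,n)=1\}|$ with $nP=\{np:p\in P\}$. A valuation on lattice polytopes is a function $\varphi$ with $\varphi(\emptyset)=0$ and $\varphi(P\cup Q)=\varphi(P)+\varphi(Q)-\varphi(P\cap Q)$ whenever $P,Q,P\cup Q,P\cap Q$ are all lattice polytopes. A unimodular transformation is a map $T(x)=Ax+b$ with $A\in \mathrm{SL}_d(\mathbb{Z})$ and $b\in\mathbb{Z}^d$; $\varphi$ is lattice-invariant if $\varphi(T(P))=\varphi(P)$ for all lattice polytopes $P$ and all unimodular transformations $T$. -}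

module Defs where

open import Data.Nat as ℕ using (ℕ; zero; suc)
open import Data.Nat.GCD using (gcd)
open import Data.Integer as ℤ using (ℤ; +_; ∣_∣)
open import Data.Rational as ℚ using (ℚ; _/_; 0ℚ; 1ℚ)
open import Data.Fin using (Fin; zero; suc)
open import Data.Vec as V using (Vec; []; _∷_; map; zipWith; foldr; replicate; lookup; removeAt; allFin; tabulate)
open import Data.List as L using (List; length)
open import Data.List.Membership.Propositional using (_∈_)
open import Data.List.Relation.Unary.Unique.Propositional using (Unique)
open import Data.List.Relation.Unary.All using (All)
open import Data.Product using (Σ; ∃; _×_; _,_)
open import Data.Sum using (_⊎_)
open import Function.Bundles using (_⇔_)
open import Relation.Binary.PropositionalEquality using (_≡_)

Point : ℕ → Set
Point d = Vec ℤ d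

QPoint : ℕ → Set
QPoint d = Vec ℚ d

toℚ : ℤ → ℚ
toℚ z = z / 1

embed : ∀ {d} → Point d → QPoint d
embed = map toℚ

-- A lattice polytope in ℝ^d is given as conv(V) for a finite list V of
-- lattice points.  The empty list represents the empty polytope.
LatticePolytope : ℕ → Set
LatticePolytope d = List (Point d)

_·ᵥ_ : ∀ {d} → ℚ → QPoint d → QPoint d
c ·ᵥ x = map (c ℚ.*_) x

_+ᵥ_ : ∀ {d} → QPoint d → QPoint d → QPoint d
_+ᵥ_ = zipWith ℚ._+_

zeroᵥ : ∀ {d} → QPoint d
zeroᵥ = replicate _ 0ℚ

combo : ∀ {d} → List ℚ → List (Point d) → QPoint d
combo (l L.∷ ls) (v L.∷ vs) = (l ·ᵥ embed v) +ᵥ combo ls vs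
combo _ _ = zeroᵥ

InPoly : ∀ {d} → LatticePolytope d → QPoint d → Set
InPoly P x =
  Σ (List ℚ) λ lam →
    (length lam ≡ length P) × All (0ℚ ℚ.≤_) lam × (L.foldr ℚ._+_ 0ℚ lam ≡ 1ℚ) × (combo lam P ≡ x)

InDilate : ∀ {d} → ℕ → LatticePolytope d → Point d → Set
InDilate n P a = Σ (QPoint _) λ p → InPoly P p × (embed a ≡ toℚ (+ n) ·ᵥ p)

gcdCond : ∀ {d} → ℕ → Point d → Set
gcdCond n a = foldr _ (λ z g → gcd ∣ z ∣ g) n a ≡ 1

-- CE(P;n) = c : the set {a ∈ nP ∩ ℤ^d : gcd(a,n)=1} is finite of cardinality c,
-- witnessed by a duplicate-free list enumerating exactly that set.
HasCE : ∀ {d} → LatticePolytope d → ℕ → ℕ → Set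
HasCE {d} P n c =
  Σ (List (Point d)) λ as →
    Unique as × (length as ≡ c) × (∀ a → (a ∈ as) ⇔ (InDilate n P a × gcdCond n a))

-- Set-theoretic relations between polytopes (compared on rational points,
-- which is equivalent for rational polytopes)
IsUnion : ∀ {d} → LatticePolytope d → LatticePolytope d → LatticePolytope d → Set
IsUnion {d} R P Q = ∀ (x : QPoint d) → InPoly R x ⇔ (InPoly P x ⊎ InPoly Q x)

IsInter : ∀ {d} → LatticePolytope d → LatticePolytope d → LatticePolytope d → Set
IsInter {d} S P Q = ∀ (x : QPoint d) → InPoly S x ⇔ (InPoly P x × InPoly Q x)

Matrix : ℕ → Set
Matrix d = Vec (Vec ℤ d) d

sign : ℕ → ℤ
sign zero = + 1
sign (suc k) = ℤ.- sign k

det : ∀ {d} → Matrix d → ℤ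
det {zero} [] = + 1
det {suc d} (r ∷ rs) =
  V.foldr _ ℤ._+_ (+ 0)
    (tabulate λ (j : Fin (suc d)) →
      sign (Data.Fin.toℕ j) ℤ.* lookup r j ℤ.* det (map (λ row → removeAt row j) rs))

applyAff : ∀ {d} → Matrix d → Point d → Point d → Point d
applyAff A b x = zipWith ℤ._+_ (map (λ row → V.foldr _ ℤ._+_ (+ 0) (zipWith ℤ._*_ row x)) A) b

-- image of conv(V) under an affine map is conv of the image of V
imageP : ∀ {d} → Matrix d → Point d → LatticePolytope d → LatticePolytope d
imageP A b P = L.map (applyAff A b) P

{-# OPTIONS --safe #-}
module Submission where

-- Membership of a rational point in conv V is a linear feasibility problem in the convex
-- weights, decidable by Fourier–Motzkin elimination. As nP lies in the box [-nB, nB]^d, for B a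
-- bound on the vertex coordinates, filtering that box lists the points counted by CE(P; n).
-- The counted points of P ∪ Q and P ∩ Q are the union and the intersection of those of P and Q,
-- so the valuation property is inclusion–exclusion for these lists. For T x = A x + b with
-- det A = 1, a ↦ A a + n b maps the counted points of P bijectively onto those of T P: by
-- Cramer's rule A⁻¹ is integral, so this map is onto the lattice points of n T P, and a and
-- A a + n b have the same common divisors with n.

open import Data.Nat using (ℕ)
open import Relation.Binary.Definitions using (DecidableEquality)
import Data.Rational

module IntegerEmbedding where

  open import Defs using (toℚ; Point; embed)
  import Data.Nat as ℕ
  import Data.Nat.Coprimality as Coprime
  open import Data.Integer as ℤ using (+_; -[1+_])
  import Data.Integer.Properties as ℤP
  open import Data.Rational as ℚ using (mkℚ)
  import Data.Rational.Properties as ℚP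
  open import Data.Vec using ([]; _∷_)
  import Data.Vec.Properties as VP
  open import Relation.Binary.PropositionalEquality

  toℚ≡mkℚ : ∀ z → toℚ z ≡ mkℚ z 0 (Coprime.sym (Coprime.1-coprimeTo _))
  toℚ≡mkℚ (+ k) = ℚP.normalize-coprime {k} {0} (Coprime.sym (Coprime.1-coprimeTo _))
  toℚ≡mkℚ -[1+ k ] = cong ℚ.-_ (ℚP.normalize-coprime {ℕ.suc k} {0} (Coprime.sym (Coprime.1-coprimeTo _)))

  toℚ-+ : ∀ z w → toℚ (z ℤ.+ w) ≡ toℚ z ℚ.+ toℚ w
  toℚ-+ z w rewrite toℚ≡mkℚ z | toℚ≡mkℚ w | ℤP.*-identityʳ z | ℤP.*-identityʳ w = refl

  toℚ-* : ∀ z w → toℚ (z ℤ.* w) ≡ toℚ z ℚ.* toℚ w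
  toℚ-* z w rewrite toℚ≡mkℚ z | toℚ≡mkℚ w = refl

  toℚ-neg : ∀ z → toℚ (ℤ.- z) ≡ ℚ.- toℚ z
  toℚ-neg z rewrite toℚ≡mkℚ z | toℚ≡mkℚ (ℤ.- z) with z
  ... | + ℕ.zero = refl
  ... | + ℕ.suc k = refl
  ... | -[1+ k ] = refl

  toℚ-mono-≤ : ∀ {z w} → z ℤ.≤ w → toℚ z ℚ.≤ toℚ w
  toℚ-mono-≤ {z} {w} z≤w rewrite toℚ≡mkℚ z | toℚ≡mkℚ w =
    ℚ.*≤* (subst₂ ℤ._≤_ (sym (ℤP.*-identityʳ z)) (sym (ℤP.*-identityʳ w)) z≤w)

  toℚ-cancel-≤ : ∀ {z w} → toℚ z ℚ.≤ toℚ w → z ℤ.≤ w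
  toℚ-cancel-≤ {z} {w} le rewrite toℚ≡mkℚ z | toℚ≡mkℚ w with le
  ... | ℚ.*≤* z≤w = subst₂ ℤ._≤_ (ℤP.*-identityʳ z) (ℤP.*-identityʳ w) z≤w

  toℚ-injective : ∀ {z w} → toℚ z ≡ toℚ w → z ≡ w
  toℚ-injective eq = ℤP.≤-antisym (toℚ-cancel-≤ (ℚP.≤-reflexive eq)) (toℚ-cancel-≤ (ℚP.≤-reflexive (sym eq)))

  embed-injective : ∀ {d} (a b : Point d) → embed a ≡ embed b → a ≡ b
  embed-injective [] [] _ = refl
  embed-injective (z ∷ a) (w ∷ b) eq =
    cong₂ _∷_ (toℚ-injective (VP.∷-injectiveˡ eq)) (embed-injective a b (VP.∷-injectiveʳ eq))


module Reciprocal (p : Data.Rational.ℚ) (p>0 : Data.Rational.0ℚ Data.Rational.< p) where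

  open import Data.Rational using (ℚ; 1ℚ; _*_; 1/_; Positive; NonZero; positive)
  import Data.Rational.Properties as ℚP
  open import Relation.Binary.PropositionalEquality using (_≡_)

  private instance
    p-positive : Positive p
    p-positive = positive p>0
    p-nonZero : NonZero p
    p-nonZero = ℚP.pos⇒nonZero p

  recip : ℚ
  recip = 1/ p

  recip-positive : Positive recip
  recip-positive = ℚP.1/pos⇒pos p

  *-recip : p * recip ≡ 1ℚ
  *-recip = ℚP.*-inverseʳ p


module FourierMotzkin where

  open import Data.Nat using (ℕ; zero; suc)
  import Data.Nat.Properties as ℕP
  open import Data.Rational using (ℚ; 0ℚ; 1ℚ; _+_; _*_; _-_; -_; _≤_; Positive)
  import Data.Rational.Properties as ℚP
  open import Data.Rational.Solver using (module +-*-Solver)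
  open import Data.List using (List; []; _∷_; map; _++_; length)
  open import Data.List.Relation.Unary.All as All using (All; []; _∷_; all?)
  open import Data.List.Relation.Unary.All.Properties using (++⁺; ++⁻; map⁺; map⁻)
  open import Relation.Binary.Bundles using (DecTotalOrder)
  open import Data.List.Extrema (DecTotalOrder.totalOrder ℚP.≤-decTotalOrder) using (max; ⊥≤max; xs≤max; max≤v⁺)
  open import Data.Product using (Σ; ∃; _×_; _,_; proj₁; proj₂)
  open import Function using (_∘_)
  open import Function.Bundles using (_⇔_; mk⇔; Equivalence)
  open import Relation.Binary.PropositionalEquality
  open import Relation.Binary.Definitions using (tri<; tri≈; tri>)
  open import Relation.Nullary using (Dec; yes; no)
  open Equivalence
  open +-*-Solver using (solve; _:=_; _:+_; _:-_; _:*_; :-_; con)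

  dot : List ℚ → List ℚ → ℚ
  dot (a ∷ as) (x ∷ xs) = a * x + dot as xs
  dot _ _ = 0ℚ

  -- (a , c) is the inequality a · x ≤ c; missing coefficients count as 0.
  Constraint : Set
  Constraint = List ℚ × ℚ

  _⊨_ : List ℚ → Constraint → Set
  x ⊨ (a , c) = dot a x ≤ c

  Feasible : ℕ → List Constraint → Set
  Feasible m cs = Σ (List ℚ) λ x → length x ≡ m × All (0ℚ ≤_) x × All (x ⊨_) cs

  dot-*ʳ : ∀ a x s → dot (map (_* s) a) x ≡ dot a x * s
  dot-*ʳ [] x s = sym (ℚP.*-zeroˡ s)
  dot-*ʳ (a ∷ as) [] s = sym (ℚP.*-zeroˡ s)
  dot-*ʳ (a ∷ as) (x ∷ xs) s rewrite dot-*ʳ as xs s =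
    solve 4 (λ a s x d → a :* s :* x :+ d :* s := (a :* x :+ d) :* s) refl a s x (dot as xs)

  addCoeffs : List ℚ → List ℚ → List ℚ
  addCoeffs (a ∷ as) (b ∷ bs) = a + b ∷ addCoeffs as bs
  addCoeffs [] bs = bs
  addCoeffs as [] = as

  dot-addCoeffs : ∀ a b x → dot (addCoeffs a b) x ≡ dot a x + dot b x
  dot-addCoeffs [] b x = sym (ℚP.+-identityˡ _)
  dot-addCoeffs (a ∷ as) [] x = sym (ℚP.+-identityʳ _)
  dot-addCoeffs (a ∷ as) (b ∷ bs) [] = sym (ℚP.+-identityʳ _)
  dot-addCoeffs (a ∷ as) (b ∷ bs) (x ∷ xs) rewrite dot-addCoeffs as bs xs =
    solve 5 (λ a b x p q → (a :+ b) :* x :+ (p :+ q) := a :* x :+ p :+ (b :* x :+ q)) refl a b x (dot as xs) (dot bs xs)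

  open Reciprocal

  rescale-⇔ : ∀ s → Positive s → ∀ {u v c} → u * s ≡ v → (u ≤ c) ⇔ (v ≤ c * s)
  rescale-⇔ s s>0 {c = c} us≡v = mk⇔
    (λ u≤c → subst (_≤ c * s) us≡v (ℚP.*-monoʳ-≤-nonNeg s {{ℚP.pos⇒nonNeg s {{s>0}}}} u≤c))
    (λ v≤cs → ℚP.*-cancelʳ-≤-pos s {{s>0}} (subst (_≤ c * s) (sym us≡v) v≤cs))

  -- A constraint on x₀ ∷ x, rescaled so that x₀ has coefficient 0, +1 or -1.
  data Normalised : Set where
    free upper lower : Constraint → Normalised

  Holds : ℚ → List ℚ → Normalised → Set
  Holds x₀ x (free k) = x ⊨ k
  Holds x₀ x (upper (a , c)) = x₀ + dot a x ≤ c
  Holds x₀ x (lower (a , c)) = - x₀ + dot a x ≤ c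

  scale : ℚ → Constraint → Constraint
  scale s (a , c) = map (_* s) a , c * s

  normalise : Constraint → Normalised
  normalise ([] , c) = free ([] , c)
  normalise (a₀ ∷ a , c) with ℚP.<-cmp a₀ 0ℚ
  ... | tri< a₀<0 _ _ = lower (scale (recip (- a₀) (ℚP.neg-antimono-< a₀<0)) (a , c))
  ... | tri≈ _ _ _ = free (a , c)
  ... | tri> _ _ a₀>0 = upper (scale (recip a₀ a₀>0) (a , c))

  upper-rescaled : ∀ a₀ s x₀ t → a₀ * s ≡ 1ℚ → (a₀ * x₀ + t) * s ≡ x₀ + t * s
  upper-rescaled a₀ s x₀ t a₀s≡1 = begin
    (a₀ * x₀ + t) * s
      ≡⟨ solve 4 (λ a₀ s x₀ t → (a₀ :* x₀ :+ t) :* s := (a₀ :* s) :* x₀ :+ t :* s) refl a₀ s x₀ t ⟩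
    (a₀ * s) * x₀ + t * s ≡⟨ cong (λ r → r * x₀ + t * s) a₀s≡1 ⟩
    1ℚ * x₀ + t * s       ≡⟨ cong (_+ t * s) (ℚP.*-identityˡ x₀) ⟩
    x₀ + t * s            ∎
    where open ≡-Reasoning

  lower-rescaled : ∀ a₀ s x₀ t → (- a₀) * s ≡ 1ℚ → (a₀ * x₀ + t) * s ≡ - x₀ + t * s
  lower-rescaled a₀ s x₀ t -a₀s≡1 = begin
    (a₀ * x₀ + t) * s
      ≡⟨ solve 4 (λ a₀ s x₀ t → (a₀ :* x₀ :+ t) :* s := :- ((:- a₀) :* s :* x₀) :+ t :* s) refl a₀ s x₀ t ⟩
    - ((- a₀) * s * x₀) + t * s ≡⟨ cong (λ r → - (r * x₀) + t * s) -a₀s≡1 ⟩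
    - (1ℚ * x₀) + t * s         ≡⟨ cong (λ r → - r + t * s) (ℚP.*-identityˡ x₀) ⟩
    - x₀ + t * s                ∎
    where open ≡-Reasoning

  normalise-correct : ∀ x₀ x k → (x₀ ∷ x) ⊨ k ⇔ Holds x₀ x (normalise k)
  normalise-correct x₀ x ([] , c) = mk⇔ (λ h → h) (λ h → h)
  normalise-correct x₀ x (a₀ ∷ a , c) with ℚP.<-cmp a₀ 0ℚ
  ... | tri< a₀<0 _ _ =
    let -a₀>0 = ℚP.neg-antimono-< a₀<0 ; s = recip (- a₀) -a₀>0 in
    rescale-⇔ s (recip-positive (- a₀) -a₀>0)
      (trans (lower-rescaled a₀ s x₀ (dot a x) (*-recip (- a₀) -a₀>0)) (cong (- x₀ +_) (sym (dot-*ʳ a x s))))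
  ... | tri≈ _ a₀≡0 _ =
    let e = trans (cong (λ r → r * x₀ + dot a x) a₀≡0) (solve 2 (λ x₀ t → con 0ℚ :* x₀ :+ t := t) refl x₀ (dot a x)) in
    mk⇔ (subst (_≤ c) e) (subst (_≤ c) (sym e))
  ... | tri> _ _ a₀>0 =
    let s = recip a₀ a₀>0 in
    rescale-⇔ s (recip-positive a₀ a₀>0)
      (trans (upper-rescaled a₀ s x₀ (dot a x) (*-recip a₀ a₀>0)) (cong (x₀ +_) (sym (dot-*ʳ a x s))))

  normalise-correct* : ∀ x₀ x cs → All ((x₀ ∷ x) ⊨_) cs ⇔ All (Holds x₀ x) (map normalise cs)
  normalise-correct* x₀ x cs = mk⇔
    (λ h → map⁺ (All.map (λ {k} → to (normalise-correct x₀ x k)) h))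
    (λ h → All.map (λ {k} → from (normalise-correct x₀ x k)) (map⁻ h))

  frees uppers lowers : List Normalised → List Constraint
  frees [] = []
  frees (free k ∷ ns) = k ∷ frees ns
  frees (upper _ ∷ ns) = frees ns
  frees (lower _ ∷ ns) = frees ns
  uppers [] = []
  uppers (free _ ∷ ns) = uppers ns
  uppers (upper k ∷ ns) = k ∷ uppers ns
  uppers (lower _ ∷ ns) = uppers ns
  lowers [] = []
  lowers (free _ ∷ ns) = lowers ns
  lowers (upper _ ∷ ns) = lowers ns
  lowers (lower k ∷ ns) = k ∷ lowers ns

  split : ∀ x₀ x ns → All (Holds x₀ x) ns →
    All (x ⊨_) (frees ns) × All (Holds x₀ x ∘ upper) (uppers ns) × All (Holds x₀ x ∘ lower) (lowers ns)
  split x₀ x [] [] = [] , [] , []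
  split x₀ x (free _ ∷ ns) (h ∷ hs) = let (f , u , l) = split x₀ x ns hs in h ∷ f , u , l
  split x₀ x (upper _ ∷ ns) (h ∷ hs) = let (f , u , l) = split x₀ x ns hs in f , h ∷ u , l
  split x₀ x (lower _ ∷ ns) (h ∷ hs) = let (f , u , l) = split x₀ x ns hs in f , u , h ∷ l

  unsplit : ∀ x₀ x ns →
    All (x ⊨_) (frees ns) → All (Holds x₀ x ∘ upper) (uppers ns) → All (Holds x₀ x ∘ lower) (lowers ns) →
    All (Holds x₀ x) ns
  unsplit x₀ x [] _ _ _ = []
  unsplit x₀ x (free _ ∷ ns) (h ∷ f) u l = h ∷ unsplit x₀ x ns f u l
  unsplit x₀ x (upper _ ∷ ns) f (h ∷ u) l = h ∷ unsplit x₀ x ns f u l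
  unsplit x₀ x (lower _ ∷ ns) f u (h ∷ l) = h ∷ unsplit x₀ x ns f u l

  combine : Constraint → Constraint → Constraint
  combine (a , c) (b , e) = addCoeffs a b , c + e

  combinations : List Constraint → List Constraint → List Constraint
  combinations [] ls = []
  combinations (u ∷ us) ls = map (combine u) ls ++ combinations us ls

  -- Since x₀ ≥ 0, each upper bound x₀ ≤ c - a · x also contributes a · x ≤ c.
  eliminate : List Constraint → List Constraint
  eliminate cs = frees ns ++ uppers ns ++ combinations (uppers ns) (lowers ns)
    where ns = map normalise cs

  upperBound lowerBound : List ℚ → Constraint → ℚ
  upperBound x (a , c) = c - dot a x
  lowerBound x (b , e) = dot b x - e

  private
    add-bounds : ∀ x₀ A B {c e} → x₀ + A ≤ c → - x₀ + B ≤ e → A + B ≤ c + e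
    add-bounds x₀ A B p q =
      subst (_≤ _) (solve 3 (λ x₀ A B → (x₀ :+ A) :+ (:- x₀ :+ B) := A :+ B) refl x₀ A B) (ℚP.+-mono-≤ p q)

    gap : ∀ A B c e → A + B ≤ c + e → B - e ≤ c - A
    gap A B c e p = subst₂ _≤_
      (solve 4 (λ A B c e → (A :+ B) :+ (:- A :- e) := B :- e) refl A B c e)
      (solve 4 (λ A B c e → (c :+ e) :+ (:- A :- e) := c :- A) refl A B c e)
      (ℚP.+-monoˡ-≤ (- A - e) p)

    below-upper : ∀ {x₀ A c} → x₀ ≤ c - A → x₀ + A ≤ c
    below-upper {x₀} {A} {c} p = subst (_ ≤_) (solve 2 (λ A c → c :- A :+ A := c) refl A c) (ℚP.+-monoˡ-≤ A p)

    above-lower : ∀ {x₀ B e} → B - e ≤ x₀ → - x₀ + B ≤ e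
    above-lower {x₀} {B} {e} p = subst₂ _≤_
      (solve 3 (λ x₀ B e → B :- e :+ (e :- x₀) := :- x₀ :+ B) refl x₀ B e)
      (solve 2 (λ x₀ e → x₀ :+ (e :- x₀) := e) refl x₀ e)
      (ℚP.+-monoˡ-≤ (e - x₀) p)

    drop-nonneg : ∀ {x₀ A c} → 0ℚ ≤ x₀ → x₀ + A ≤ c → A ≤ c
    drop-nonneg {x₀} {A} 0≤x₀ p = ℚP.≤-trans (subst (_≤ x₀ + A) (ℚP.+-identityˡ A) (ℚP.+-monoˡ-≤ A 0≤x₀)) p

    slack-nonneg : ∀ {A c} → A ≤ c → 0ℚ ≤ c - A
    slack-nonneg {A} {c} p = subst (_≤ c - A) (ℚP.+-inverseʳ A) (ℚP.+-monoˡ-≤ (- A) p)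

  combinations-sound : ∀ x₀ x us ls → All (Holds x₀ x ∘ upper) us → All (Holds x₀ x ∘ lower) ls →
    All (x ⊨_) (combinations us ls)
  combinations-sound x₀ x [] ls [] _ = []
  combinations-sound x₀ x ((a , c) ∷ us) ls (hu ∷ hus) hls =
    ++⁺ (map⁺ {f = combine (a , c)} (All.map (λ {(b , e)} hl → subst (_≤ c + e) (sym (dot-addCoeffs a b x))
                                                                   (add-bounds x₀ (dot a x) (dot b x) hu hl)) hls))
        (combinations-sound x₀ x us ls hus hls)

  combinations-complete : ∀ x us ls → All (x ⊨_) (combinations us ls) →
    All (λ u → All (λ l → lowerBound x l ≤ upperBound x u) ls) us
  combinations-complete x [] ls _ = []
  combinations-complete x ((a , c) ∷ us) ls h =
    let (here , rest) = ++⁻ (map (combine (a , c)) ls) h in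
    All.map (λ {(b , e)} hl → gap (dot a x) (dot b x) c e (subst (_≤ c + e) (dot-addCoeffs a b x) hl))
            (map⁻ {f = combine (a , c)} here)
      ∷ combinations-complete x us ls rest

  eliminate-sound : ∀ cs x₀ x → 0ℚ ≤ x₀ → All ((x₀ ∷ x) ⊨_) cs → All (x ⊨_) (eliminate cs)
  eliminate-sound cs x₀ x 0≤x₀ h with split x₀ x (map normalise cs) (to (normalise-correct* x₀ x cs) h)
  ... | f , u , l = ++⁺ f (++⁺ (All.map (drop-nonneg 0≤x₀) u) (combinations-sound x₀ x _ _ u l))

  -- Take for x₀ the largest of 0 and the lower bounds: every upper bound dominates all of them.
  eliminate-complete : ∀ cs x → All (x ⊨_) (eliminate cs) → ∃ λ x₀ → 0ℚ ≤ x₀ × All ((x₀ ∷ x) ⊨_) cs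
  eliminate-complete cs x h =
    x₀ , ⊥≤max 0ℚ lows ,
    from (normalise-correct* x₀ x cs) (unsplit x₀ x ns frees⊨ (All.map below-upper x₀≤ups) (All.map above-lower lows≤x₀))
    where
    ns : List Normalised
    ns = map normalise cs
    lows : List ℚ
    lows = map (lowerBound x) (lowers ns)
    x₀ : ℚ
    x₀ = max 0ℚ lows
    frees⊨ : All (x ⊨_) (frees ns)
    frees⊨ = proj₁ (++⁻ (frees ns) h)
    rest⊨ : All (x ⊨_) (uppers ns ++ combinations (uppers ns) (lowers ns))
    rest⊨ = proj₂ (++⁻ (frees ns) h)
    x₀≤ups : All (λ k → x₀ ≤ upperBound x k) (uppers ns)
    x₀≤ups = All.zipWith (λ (k⊨ , lows≤k) → max≤v⁺ (slack-nonneg k⊨) (map⁺ lows≤k))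
      (proj₁ (++⁻ (uppers ns) rest⊨) , combinations-complete x (uppers ns) (lowers ns) (proj₂ (++⁻ (uppers ns) rest⊨)))
    lows≤x₀ : All (λ k → lowerBound x k ≤ x₀) (lowers ns)
    lows≤x₀ = map⁻ (xs≤max 0ℚ lows)

  feasible? : ∀ m cs → Dec (Feasible m cs)
  feasible? zero cs with all? (λ (a , c) → dot a [] ℚP.≤? c) cs
  ... | yes h = yes ([] , refl , [] , h)
  ... | no ¬h = no λ { ([] , _ , _ , h) → ¬h h }
  feasible? (suc m) cs with feasible? m (eliminate cs)
  ... | yes (x , len , nonneg , h) =
    let (x₀ , 0≤x₀ , h₀) = eliminate-complete cs x h in yes (x₀ ∷ x , cong suc len , 0≤x₀ ∷ nonneg , h₀)
  ... | no ¬f = no λ { (x₀ ∷ x , len , 0≤x₀ ∷ nonneg , h) →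
    ¬f (x , ℕP.suc-injective len , nonneg , eliminate-sound cs x₀ x 0≤x₀ h) }


module ConvexHull where

  open import Defs
  open FourierMotzkin
  open import Data.Nat using (zero; suc)
  import Data.Nat.Properties as ℕP
  open import Data.Rational using (ℚ; 0ℚ; 1ℚ; _+_; -_; _≤_)
  import Data.Rational.Properties as ℚP
  open import Data.Rational.Solver using (module +-*-Solver)
  open import Data.Vec as V using ([]; _∷_)
  import Data.Vec.Properties as VP
  open import Data.List as L using (List; []; _∷_; map; _++_; length)
  open import Data.List.Relation.Unary.All using (All; []; _∷_)
  open import Data.List.Relation.Unary.All.Properties using (++⁺; ++⁻)
  open import Data.Product using (_,_)
  open import Function using (_∘_; const)
  open import Function.Bundles using (_⇔_; mk⇔; Equivalence)
  open import Relation.Binary.PropositionalEquality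
  open import Relation.Nullary using (Dec)
  import Relation.Nullary.Decidable as Dec
  open import Function.Properties.Equivalence using () renaming (sym to ⇔-sym)
  open Equivalence
  open +-*-Solver using (solve; _:=_; _:+_; _:*_; :-_)

  sumℚ : List ℚ → ℚ
  sumℚ = L.foldr _+_ 0ℚ

  firstCoords : ∀ {d} → List (Point (suc d)) → List ℚ
  firstCoords = map (toℚ ∘ V.head)

  combo-∷ : ∀ {d} lam (P : List (Point (suc d))) →
    combo lam P ≡ dot (firstCoords P) lam ∷ combo lam (map V.tail P)
  combo-∷ [] [] = refl
  combo-∷ [] (v ∷ P) = refl
  combo-∷ (l ∷ ls) [] = refl
  combo-∷ (l ∷ ls) ((h ∷ t) ∷ P) rewrite combo-∷ ls P | ℚP.*-comm l (toℚ h) = refl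

  dot-neg : ∀ a x → dot (map -_ a) x ≡ - dot a x
  dot-neg [] x = refl
  dot-neg (a ∷ as) [] = refl
  dot-neg (a ∷ as) (x ∷ xs) rewrite dot-neg as xs =
    solve 3 (λ a x d → (:- a) :* x :+ (:- d) := :- (a :* x :+ d)) refl a x (dot as xs)

  equation : List ℚ → ℚ → List Constraint
  equation a c = (a , c) ∷ (map -_ a , - c) ∷ []

  equation-correct : ∀ a c x → All (x ⊨_) (equation a c) ⇔ (dot a x ≡ c)
  equation-correct a c x = mk⇔
    (λ { (a·x≤c ∷ -a·x≤-c ∷ []) → ℚP.≤-antisym a·x≤c
          (subst₂ _≤_ (neg-involutive c) (neg-involutive _) (ℚP.neg-antimono-≤ (subst (_≤ - c) (dot-neg a x) -a·x≤-c))) })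
    (λ a·x≡c → ℚP.≤-reflexive a·x≡c ∷ ℚP.≤-reflexive (trans (dot-neg a x) (cong -_ a·x≡c)) ∷ [])
    where
    neg-involutive : ∀ q → - - q ≡ q
    neg-involutive q = solve 1 (λ q → :- :- q := q) refl q

  coordinateEquations : ∀ {d} → List (Point d) → QPoint d → List Constraint
  coordinateEquations {zero} P [] = []
  coordinateEquations {suc d} P (xⱼ ∷ x) = equation (firstCoords P) xⱼ ++ coordinateEquations (map V.tail P) x

  coordinateEquations-correct : ∀ {d} lam (P : List (Point d)) x →
    All (lam ⊨_) (coordinateEquations P x) ⇔ (combo lam P ≡ x)
  coordinateEquations-correct {zero} lam P [] = mk⇔ (λ _ → []-unique (combo lam P)) (λ _ → [])
    where
    []-unique : (v : QPoint 0) → v ≡ []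
    []-unique [] = refl
  coordinateEquations-correct {suc d} lam P (xⱼ ∷ x) = mk⇔
    (λ h → let (hⱼ , hs) = ++⁻ (equation (firstCoords P) xⱼ) h in
      trans (combo-∷ lam P) (cong₂ _∷_ (to (equation-correct _ xⱼ lam) hⱼ) (to rest hs)))
    (λ e → let e′ = trans (sym (combo-∷ lam P)) e in
      ++⁺ (from (equation-correct _ xⱼ lam) (VP.∷-injectiveˡ e′)) (from rest (VP.∷-injectiveʳ e′)))
    where
    rest : All (lam ⊨_) (coordinateEquations (map V.tail P) x) ⇔ (combo lam (map V.tail P) ≡ x)
    rest = coordinateEquations-correct lam (map V.tail P) x

  hullConstraints : ∀ {d} → List (Point d) → QPoint d → List Constraint
  hullConstraints P x = equation (map (const 1ℚ) P) 1ℚ ++ coordinateEquations P x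

  dot-ones : ∀ {d} (P : List (Point d)) lam → length lam ≡ length P → dot (map (const 1ℚ) P) lam ≡ sumℚ lam
  dot-ones [] [] _ = refl
  dot-ones (v ∷ P) (l ∷ lam) len rewrite dot-ones P lam (ℕP.suc-injective len) | ℚP.*-identityˡ l = refl

  InPoly⇔Feasible : ∀ {d} (P : List (Point d)) x → InPoly P x ⇔ Feasible (length P) (hullConstraints P x)
  InPoly⇔Feasible P x = mk⇔
    (λ (lam , len , nonneg , sum≡1 , combo≡x) →
      lam , len , nonneg ,
      ++⁺ (from (equation-correct _ 1ℚ lam) (trans (dot-ones P lam len) sum≡1))
          (from (coordinateEquations-correct lam P x) combo≡x))
    (λ (lam , len , nonneg , h) → let (h₁ , hs) = ++⁻ (equation (map (const 1ℚ) P) 1ℚ) h in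
      lam , len , nonneg ,
      trans (sym (dot-ones P lam len)) (to (equation-correct _ 1ℚ lam) h₁) , to (coordinateEquations-correct lam P x) hs)

  InPoly? : ∀ {d} (P : List (Point d)) x → Dec (InPoly P x)
  InPoly? P x = Dec.map (⇔-sym (InPoly⇔Feasible P x)) (feasible? (length P) (hullConstraints P x))


module Scaling (m : ℕ) where

  open import Defs
  open IntegerEmbedding using (toℚ≡mkℚ)
  open import Data.Nat using (suc)
  open import Data.Integer using (+_)
  open import Data.Rational using (ℚ; 0ℚ; 1ℚ; _*_; _<_; NonNegative; nonNegative)
  import Data.Rational.Properties as ℚP
  open import Data.Vec using ([]; _∷_)
  import Data.Vec.Properties as VP
  open import Relation.Binary.PropositionalEquality

  k : ℚ
  k = toℚ (+ suc m)

  0<k : 0ℚ < k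
  0<k rewrite toℚ≡mkℚ (+ suc m) = ℚP.positive⁻¹ _

  k-nonNegative : NonNegative k
  k-nonNegative = nonNegative (ℚP.<⇒≤ 0<k)

  k⁻¹ : ℚ
  k⁻¹ = Reciprocal.recip k 0<k

  k⁻¹*k≡1 : k⁻¹ * k ≡ 1ℚ
  k⁻¹*k≡1 = trans (ℚP.*-comm k⁻¹ k) (Reciprocal.*-recip k 0<k)

  k·k⁻¹·y≡y : ∀ {d} (y : QPoint d) → k ·ᵥ (k⁻¹ ·ᵥ y) ≡ y
  k·k⁻¹·y≡y [] = refl
  k·k⁻¹·y≡y (y ∷ ys) = cong₂ _∷_ (begin
    k * (k⁻¹ * y) ≡⟨ ℚP.*-assoc k k⁻¹ y ⟨
    (k * k⁻¹) * y ≡⟨ cong (_* y) (Reciprocal.*-recip k 0<k) ⟩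
    1ℚ * y        ≡⟨ ℚP.*-identityˡ y ⟩
    y             ∎) (k·k⁻¹·y≡y ys)
    where open ≡-Reasoning

  y≡k·p⇒p≡k⁻¹·y : ∀ {d} (y p : QPoint d) → y ≡ k ·ᵥ p → p ≡ k⁻¹ ·ᵥ y
  y≡k·p⇒p≡k⁻¹·y [] [] _ = refl
  y≡k·p⇒p≡k⁻¹·y (y ∷ ys) (p ∷ ps) eq = cong₂ _∷_ (sym (begin
    k⁻¹ * y       ≡⟨ cong (k⁻¹ *_) (VP.∷-injectiveˡ eq) ⟩
    k⁻¹ * (k * p) ≡⟨ ℚP.*-assoc k⁻¹ k p ⟨
    (k⁻¹ * k) * p ≡⟨ cong (_* p) k⁻¹*k≡1 ⟩
    1ℚ * p        ≡⟨ ℚP.*-identityˡ p ⟩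
    p             ∎)) (y≡k·p⇒p≡k⁻¹·y ys ps (VP.∷-injectiveʳ eq))
    where open ≡-Reasoning


module Finiteness where

  open import Defs
  open IntegerEmbedding
  open FourierMotzkin using (dot)
  open ConvexHull
  open import Data.Nat as ℕ using (ℕ; zero; suc; _⊔_; s≤s)
  import Data.Nat.Properties as ℕP
  open import Data.Integer as ℤ using (ℤ; +_; -[1+_]; ∣_∣)
  import Data.Integer.Properties as ℤP
  open import Data.Rational as ℚ using (ℚ; 0ℚ; 1ℚ; _*_; -_; _≤_)
  import Data.Rational.Properties as ℚP
  open import Data.Rational.Solver using (module +-*-Solver)
  open import Data.Vec as V using ([]; _∷_)
  import Data.Vec.Properties as VP
  import Data.Vec.Relation.Unary.All as VA
  open import Data.List as L using (List; []; _∷_; map; length)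
  import Data.List.Properties as LP
  open import Data.List.Relation.Unary.All as All using (All; []; _∷_)
  open import Data.List.Relation.Unary.All.Properties using (map⁺)
  open import Data.List.Relation.Unary.Any using (here; there)
  open import Data.List.Membership.Propositional using (_∈_)
  open import Data.List.Membership.Propositional.Properties using (∈-filter⁺; ∈-filter⁻)
  import Data.List.Membership.Propositional.Properties as ∈
  open import Data.List.Relation.Unary.Unique.DecPropositional.Properties using (deduplicate-!)
  open import Data.Product using (∃; _×_; _,_; proj₁; proj₂)
  open import Data.Sum using (inj₁; inj₂)
  open import Function using (_∘_)
  open import Function.Bundles using (_⇔_; mk⇔)
  open import Relation.Binary.PropositionalEquality
  open import Relation.Nullary using (Dec)
  open import Relation.Nullary.Decidable using (_×-dec_)
  import Relation.Nullary.Decidable as Dec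
  open import Function.Properties.Equivalence using () renaming (sym to ⇔-sym)

  ∣z∣≤B⇒bounded : ∀ z B → ∣ z ∣ ℕ.≤ B → ℤ.- (+ B) ℤ.≤ z × z ℤ.≤ + B
  ∣z∣≤B⇒bounded (+ _) B h = ℤP.neg-≤-pos , ℤ.+≤+ h
  ∣z∣≤B⇒bounded -[1+ _ ] (suc B) (s≤s h) = ℤ.-≤- h , ℤ.-≤+

  bounded⇒∣z∣≤B : ∀ z B → ℤ.- (+ B) ℤ.≤ z → z ℤ.≤ + B → ∣ z ∣ ℕ.≤ B
  bounded⇒∣z∣≤B (+ _) B _ (ℤ.+≤+ h) = h
  bounded⇒∣z∣≤B -[1+ _ ] (suc B) (ℤ.-≤- h) _ = s≤s h

  symmetricRange : ℕ → List ℤ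
  symmetricRange zero = + 0 ∷ []
  symmetricRange (suc B) = + suc B ∷ -[1+ B ] ∷ symmetricRange B

  ∈-symmetricRange : ∀ z B → ∣ z ∣ ℕ.≤ B → z ∈ symmetricRange B
  ∈-symmetricRange (+ zero) zero _ = here refl
  ∈-symmetricRange (+ k) (suc B) h with ℕP.m≤n⇒m<n∨m≡n h
  ... | inj₂ refl = here refl
  ... | inj₁ (s≤s h′) = there (there (∈-symmetricRange (+ k) B h′))
  ∈-symmetricRange -[1+ k ] (suc B) (s≤s h) with ℕP.m≤n⇒m<n∨m≡n h
  ... | inj₂ refl = there (here refl)
  ... | inj₁ h′ = there (there (∈-symmetricRange -[1+ k ] B h′))

  Bounded : ∀ {d} → ℕ → Point d → Set
  Bounded B = VA.All (λ z → ∣ z ∣ ℕ.≤ B)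

  box : ∀ d → ℕ → List (Point d)
  box zero B = [] ∷ []
  box (suc d) B = L.cartesianProductWith _∷_ (symmetricRange B) (box d B)

  ∈-box : ∀ {d B} (a : Point d) → Bounded B a → a ∈ box d B
  ∈-box [] VA.[] = here refl
  ∈-box {B = B} (z ∷ a) (h VA.∷ hs) = ∈.∈-cartesianProductWith⁺ _∷_ (∈-symmetricRange z B h) (∈-box a hs)

  maxAbs : ∀ {d} → Point d → ℕ
  maxAbs [] = 0
  maxAbs (z ∷ v) = ∣ z ∣ ⊔ maxAbs v

  Bounded-mono : ∀ {d B C} (v : Point d) → B ℕ.≤ C → Bounded B v → Bounded C v
  Bounded-mono v B≤C = VA.map (λ h → ℕP.≤-trans h B≤C)

  Bounded-maxAbs : ∀ {d} (v : Point d) → Bounded (maxAbs v) v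
  Bounded-maxAbs [] = VA.[]
  Bounded-maxAbs (z ∷ v) = ℕP.m≤m⊔n _ _ VA.∷ Bounded-mono v (ℕP.m≤n⊔m _ _) (Bounded-maxAbs v)

  vertexBound : ∀ {d} → List (Point d) → ℕ
  vertexBound [] = 0
  vertexBound (v ∷ P) = maxAbs v ⊔ vertexBound P

  Bounded-vertexBound : ∀ {d} (P : List (Point d)) → All (Bounded (vertexBound P)) P
  Bounded-vertexBound [] = []
  Bounded-vertexBound (v ∷ P) =
    Bounded-mono v (ℕP.m≤m⊔n _ _) (Bounded-maxAbs v) ∷ All.map (Bounded-mono _ (ℕP.m≤n⊔m _ _)) (Bounded-vertexBound P)

  Within : ℚ → ℚ → Set
  Within M q = - M ≤ q × q ≤ M

  dot-within : ∀ M cs lam → length lam ≡ length cs → All (Within M) cs → All (0ℚ ≤_) lam →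
    Within (M * sumℚ lam) (dot cs lam)
  dot-within M [] [] _ [] [] = ℚP.≤-reflexive (cong -_ (ℚP.*-zeroʳ M)) , ℚP.≤-reflexive (sym (ℚP.*-zeroʳ M))
  dot-within M (c ∷ cs) (l ∷ lam) len ((-M≤c , c≤M) ∷ hs) (0≤l ∷ nonneg)
    with dot-within M cs lam (ℕP.suc-injective len) hs nonneg
  ... | lo , hi =
    subst (_≤ _) (solve 3 (λ M l S → (:- M) :* l :+ (:- (M :* S)) := :- (M :* (l :+ S))) refl M l (sumℚ lam))
      (ℚP.+-mono-≤ (ℚP.*-monoʳ-≤-nonNeg l {{ℚ.nonNegative 0≤l}} -M≤c) lo) ,
    subst (_ ≤_) (sym (ℚP.*-distribˡ-+ M l (sumℚ lam)))
      (ℚP.+-mono-≤ (ℚP.*-monoʳ-≤-nonNeg l {{ℚ.nonNegative 0≤l}} c≤M) hi)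
    where open +-*-Solver using (solve; _:=_; _:+_; _:*_; :-_)

  toℚ-within : ∀ {z B} → ∣ z ∣ ℕ.≤ B → Within (toℚ (+ B)) (toℚ z)
  toℚ-within {z} {B} h = let (lo , hi) = ∣z∣≤B⇒bounded z B h in
    subst (_≤ toℚ z) (toℚ-neg (+ B)) (toℚ-mono-≤ lo) , toℚ-mono-≤ hi

  combo-within : ∀ {d} B lam (P : List (Point d)) → length lam ≡ length P → All (0ℚ ≤_) lam → sumℚ lam ≡ 1ℚ →
    All (Bounded B) P → VA.All (Within (toℚ (+ B))) (combo lam P)
  combo-within {zero} B lam P _ _ _ _ with combo lam P
  ... | [] = VA.[]
  combo-within {suc d} B lam P len nonneg sum≡1 bounded rewrite combo-∷ lam P =
    subst (λ M → Within M (dot (firstCoords P) lam)) (trans (cong (toℚ (+ B) *_) sum≡1) (ℚP.*-identityʳ (toℚ (+ B))))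
      (dot-within (toℚ (+ B)) (firstCoords P) lam (trans len (sym (LP.length-map _ P)))
        (map⁺ {f = toℚ ∘ V.head} (All.map (λ { {z ∷ _} (h VA.∷ _) → toℚ-within {z} h }) bounded)) nonneg)
    VA.∷ combo-within B lam (map V.tail P) (trans len (sym (LP.length-map _ P))) nonneg sum≡1
      (map⁺ {f = V.tail} (All.map (λ { {_ ∷ _} (_ VA.∷ hs) → hs }) bounded))

  module _ (m : ℕ) where
    open Scaling m

    private
      n : ℕ
      n = suc m

    scaled-Bounded : ∀ {d} B (a : Point d) x → embed a ≡ k ·ᵥ x → VA.All (Within (toℚ (+ B))) x → Bounded (n ℕ.* B) a
    scaled-Bounded B [] [] _ VA.[] = VA.[]
    scaled-Bounded B (z ∷ a) (q ∷ x) eq ((lo , hi) VA.∷ hs) =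
      bounded⇒∣z∣≤B z (n ℕ.* B)
        (toℚ-cancel-≤ (subst₂ _≤_ k*-B≡-nB (sym z≡kq) (ℚP.*-monoˡ-≤-nonNeg k {{k-nonNegative}} lo)))
        (toℚ-cancel-≤ (subst₂ _≤_ (sym z≡kq) k*B≡nB (ℚP.*-monoˡ-≤-nonNeg k {{k-nonNegative}} hi)))
      VA.∷ scaled-Bounded B a x (VP.∷-injectiveʳ eq) hs
      where
      open +-*-Solver using (solve; _:=_; _:*_; :-_)
      z≡kq : toℚ z ≡ k * q
      z≡kq = VP.∷-injectiveˡ eq
      k*B≡nB : k * toℚ (+ B) ≡ toℚ (+ (n ℕ.* B))
      k*B≡nB = trans (sym (toℚ-* (+ n) (+ B))) (cong toℚ (sym (ℤP.pos-* n B)))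
      k*-B≡-nB : k * - toℚ (+ B) ≡ toℚ (ℤ.- (+ (n ℕ.* B)))
      k*-B≡-nB = trans (solve 2 (λ k M → k :* (:- M) := :- (k :* M)) refl k (toℚ (+ B)))
        (trans (cong -_ k*B≡nB) (sym (toℚ-neg (+ (n ℕ.* B)))))

    InDilate⇒∈box : ∀ {d} (P : LatticePolytope d) a → InDilate n P a → a ∈ box d (n ℕ.* vertexBound P)
    InDilate⇒∈box P a (p , (lam , len , nonneg , sum≡1 , combo≡p) , a≡kp) = ∈-box a
      (scaled-Bounded (vertexBound P) a p a≡kp
        (subst (VA.All _) combo≡p (combo-within (vertexBound P) lam P len nonneg sum≡1 (Bounded-vertexBound P))))

    InDilate⇔InPoly : ∀ {d} (P : LatticePolytope d) a → InDilate n P a ⇔ InPoly P (k⁻¹ ·ᵥ embed a)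
    InDilate⇔InPoly P a = mk⇔
      (λ (p , p∈P , a≡kp) → subst (InPoly P) (y≡k·p⇒p≡k⁻¹·y (embed a) p a≡kp) p∈P)
      (λ h → k⁻¹ ·ᵥ embed a , h , sym (k·k⁻¹·y≡y (embed a)))

    Counted? : ∀ {d} (P : LatticePolytope d) a → Dec (InDilate n P a × gcdCond n a)
    Counted? P a = Dec.map (⇔-sym (InDilate⇔InPoly P a)) (InPoly? P _) ×-dec (_ ℕP.≟ 1)

    HasCE-exists : ∀ {d} (P : LatticePolytope d) → ∃ λ c → HasCE P n c
    HasCE-exists {d} P = length as , as , deduplicate-! _≟_ counted , refl , λ a → mk⇔
      (λ a∈as → proj₂ (∈-filter⁻ (Counted? P) {xs = candidates} (∈.∈-deduplicate⁻ _≟_ counted a∈as)))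
      (λ h → ∈.∈-deduplicate⁺ _≟_ (∈-filter⁺ (Counted? P) (InDilate⇒∈box P a (proj₁ h)) h))
      where
      _≟_ : DecidableEquality (Point d)
      _≟_ = VP.≡-dec ℤ._≟_
      candidates counted as : List (Point d)
      candidates = box d (n ℕ.* vertexBound P)
      counted = L.filter (Counted? P) candidates
      as = L.deduplicate _≟_ counted


module Counting {A : Set} (_≟_ : DecidableEquality A) where

  open import Relation.Binary.PropositionalEquality
  open import Data.Nat using (suc; _+_; _≤_; z≤n; s≤s)
  import Data.Nat.Properties as ℕP
  open import Data.List using (List; []; _∷_; length; filter)
  import Data.List.Properties as LP
  open import Data.List.Relation.Unary.All as All using (All; []; _∷_)
  open import Data.List.Relation.Unary.Any using (here; there)
  import Data.List.Relation.Unary.Any as Any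
  open import Data.List.Membership.Propositional using (_∈_)
  open import Data.List.Membership.Propositional.Properties using (∈-filter⁺; ∈-filter⁻)
  open import Data.List.Membership.DecPropositional _≟_ using (_∈?_)
  open import Data.List.Relation.Binary.Subset.Propositional using (_⊆_)
  open import Data.List.Relation.Unary.Unique.Propositional using (Unique)
  open import Data.List.Relation.Unary.Unique.Propositional.Properties using (filter⁺)
  open import Data.List.Relation.Unary.AllPairs using (_∷_)
  open import Data.Product using (_×_; _,_; proj₂)
  open import Data.Sum using (_⊎_; inj₁; inj₂)
  import Data.Sum as Sum
  open import Data.Empty using (⊥-elim)
  open import Function.Bundles using (_⇔_; Equivalence)
  open import Relation.Nullary using (yes; no; ¬_; ¬?)
  open import Relation.Nullary.Decidable using (_×-dec_)
  open import Relation.Unary using (Decidable)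
  open Equivalence

  Unique-⊆⇒length≤ : ∀ (xs ys : List A) → Unique xs → Unique ys → xs ⊆ ys → length xs ≤ length ys
  Unique-⊆⇒length≤ [] ys _ _ _ = z≤n
  Unique-⊆⇒length≤ (x ∷ xs) ys (x∉xs ∷ xs!) ys! xs⊆ys =
    ℕP.≤-trans (s≤s (Unique-⊆⇒length≤ xs ys′ xs! (filter⁺ ≢x? ys!) xs⊆ys′))
      (LP.filter-notAll (≢x?) ys (Any.map (λ x≡y x≢y → x≢y x≡y) (xs⊆ys (here refl))))
    where
    ≢x? : Decidable (λ y → ¬ x ≡ y)
    ≢x? y = ¬? (x ≟ y)
    ys′ : List A
    ys′ = filter ≢x? ys
    xs⊆ys′ : xs ⊆ ys′
    xs⊆ys′ a∈xs = ∈-filter⁺ ≢x? (xs⊆ys (there a∈xs)) (All.lookup x∉xs a∈xs)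

  Unique-⊆⊇⇒length≡ : ∀ (xs ys : List A) → Unique xs → Unique ys → xs ⊆ ys → ys ⊆ xs → length xs ≡ length ys
  Unique-⊆⊇⇒length≡ xs ys xs! ys! xs⊆ys ys⊆xs =
    ℕP.≤-antisym (Unique-⊆⇒length≤ xs ys xs! ys! xs⊆ys) (Unique-⊆⇒length≤ ys xs ys! xs! ys⊆xs)

  length-filter-⊎ : ∀ {X Y : A → Set} (X? : Decidable X) (Y? : Decidable Y) zs → All (λ a → X a ⊎ Y a) zs →
    length (filter X? zs) + length (filter Y? zs) ≡ length zs + length (filter (λ a → X? a ×-dec Y? a) zs)
  length-filter-⊎ X? Y? [] [] = refl
  length-filter-⊎ X? Y? (z ∷ zs) (h ∷ hs) with X? z | Y? z | length-filter-⊎ X? Y? zs hs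
  ... | yes _ | yes _ | ih = cong suc (trans (ℕP.+-suc _ _) (trans (cong suc ih) (sym (ℕP.+-suc _ _))))
  ... | yes _ | no _  | ih = cong suc ih
  ... | no _  | yes _ | ih = trans (ℕP.+-suc _ _) (cong suc ih)
  ... | no ¬x | no ¬y | _ = ⊥-elim (Sum.[ ¬x , ¬y ] h)

  length-∪+length-∩ : ∀ (xs ys zs ws : List A) → Unique xs → Unique ys → Unique zs → Unique ws →
    (∀ a → a ∈ zs ⇔ (a ∈ xs ⊎ a ∈ ys)) → (∀ a → a ∈ ws ⇔ (a ∈ xs × a ∈ ys)) →
    length zs + length ws ≡ length xs + length ys
  length-∪+length-∩ xs ys zs ws xs! ys! zs! ws! zs≈∪ ws≈∩ = begin
    length zs + length ws                              ≡⟨ cong (length zs +_) ws≡ ⟩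
    length zs + length (filter X∩Y? zs)                ≡⟨ length-filter-⊎ X? Y? zs (All.tabulate (to (zs≈∪ _))) ⟨
    length (filter X? zs) + length (filter Y? zs)      ≡⟨ cong₂ _+_ xs≡ ys≡ ⟨
    length xs + length ys                              ∎
    where
    open ≡-Reasoning
    X? : Decidable (_∈ xs)
    X? a = a ∈? xs
    Y? : Decidable (_∈ ys)
    Y? a = a ∈? ys
    X∩Y? : Decidable (λ a → a ∈ xs × a ∈ ys)
    X∩Y? a = X? a ×-dec Y? a
    xs⊆zs : xs ⊆ zs
    xs⊆zs a∈xs = from (zs≈∪ _) (inj₁ a∈xs)
    ys⊆zs : ys ⊆ zs
    ys⊆zs a∈ys = from (zs≈∪ _) (inj₂ a∈ys)
    xs≡ : length xs ≡ length (filter X? zs)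
    xs≡ = Unique-⊆⊇⇒length≡ xs _ xs! (filter⁺ X? zs!)
      (λ a∈xs → ∈-filter⁺ X? (xs⊆zs a∈xs) a∈xs) (λ a∈ → proj₂ (∈-filter⁻ X? {xs = zs} a∈))
    ys≡ : length ys ≡ length (filter Y? zs)
    ys≡ = Unique-⊆⊇⇒length≡ ys _ ys! (filter⁺ Y? zs!)
      (λ a∈ys → ∈-filter⁺ Y? (ys⊆zs a∈ys) a∈ys) (λ a∈ → proj₂ (∈-filter⁻ Y? {xs = zs} a∈))
    ws≡ : length ws ≡ length (filter X∩Y? zs)
    ws≡ = Unique-⊆⊇⇒length≡ ws _ ws! (filter⁺ X∩Y? zs!)
      (λ a∈ws → let (a∈xs , a∈ys) = to (ws≈∩ _) a∈ws in ∈-filter⁺ X∩Y? (xs⊆zs a∈xs) (a∈xs , a∈ys))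
      (λ a∈ → from (ws≈∩ _) (proj₂ (∈-filter⁻ X∩Y? {xs = zs} a∈)))


module Determinant where

  open import Data.Nat as ℕ using (ℕ; zero; suc; z≤n; s≤s; _<_; _≤_)
  import Data.Nat.Properties as ℕP
  open import Data.Rational using (ℚ; 0ℚ; 1ℚ; _+_; _*_; -_)
  import Data.Rational.Properties as ℚP
  open import Data.Rational.Solver using (module +-*-Solver)
  open import Data.Empty using (⊥-elim)
  open import Relation.Binary.PropositionalEquality
  open import Relation.Binary.Definitions using (tri<; tri≈; tri>)
  open import Relation.Nullary using (yes; no)
  open +-*-Solver using (solve; _:=_; _:+_; _:*_; :-_; con)

  -- Matrices indexed by ℕ × ℕ, so that minors need no re-indexing of types;
  -- a statement about dimension d only looks at the entries below d.
  Mat : Set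
  Mat = ℕ → ℕ → ℚ

  sumBelow : ℕ → (ℕ → ℚ) → ℚ
  sumBelow zero g = 0ℚ
  sumBelow (suc d) g = g 0 + sumBelow d (λ j → g (suc j))

  signℚ : ℕ → ℚ
  signℚ zero = 1ℚ
  signℚ (suc k) = - signℚ k

  punchIn : ℕ → ℕ → ℕ
  punchIn zero c = suc c
  punchIn (suc j) zero = zero
  punchIn (suc j) (suc c) = suc (punchIn j c)

  punchOut : ℕ → ℕ → ℕ
  punchOut zero i = ℕ.pred i
  punchOut (suc j) zero = zero
  punchOut (suc j) (suc i) = suc (punchOut j i)

  minor : ℕ → Mat → Mat
  minor j M r c = M (suc r) (punchIn j c)

  detMat : ℕ → Mat → ℚ
  detMat zero M = 1ℚ
  detMat (suc d) M = sumBelow (suc d) (λ j → signℚ j * M 0 j * detMat d (minor j M))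

  sumBelow-cong : ∀ d {g h : ℕ → ℚ} → (∀ j → j < d → g j ≡ h j) → sumBelow d g ≡ sumBelow d h
  sumBelow-cong zero _ = refl
  sumBelow-cong (suc d) g≡h = cong₂ _+_ (g≡h 0 (s≤s z≤n)) (sumBelow-cong d (λ j j<d → g≡h (suc j) (s≤s j<d)))

  sumBelow-linear : ∀ d s t (f g : ℕ → ℚ) →
    sumBelow d (λ j → s * f j + t * g j) ≡ s * sumBelow d f + t * sumBelow d g
  sumBelow-linear zero s t f g = solve 2 (λ s t → con 0ℚ := s :* con 0ℚ :+ t :* con 0ℚ) refl s t
  sumBelow-linear (suc d) s t f g rewrite sumBelow-linear d s t (λ j → f (suc j)) (λ j → g (suc j)) =
    solve 6 (λ s t a b A B → s :* a :+ t :* b :+ (s :* A :+ t :* B) := s :* (a :+ A) :+ t :* (b :+ B)) refl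
      s t (f 0) (g 0) (sumBelow d (λ j → f (suc j))) (sumBelow d (λ j → g (suc j)))

  sumBelow-zero : ∀ d {g : ℕ → ℚ} → (∀ j → j < d → g j ≡ 0ℚ) → sumBelow d g ≡ 0ℚ
  sumBelow-zero zero _ = refl
  sumBelow-zero (suc d) g≡0 rewrite g≡0 0 (s≤s z≤n) | sumBelow-zero d (λ j j<d → g≡0 (suc j) (s≤s j<d)) = refl

  sumBelow-single : ∀ d i {g : ℕ → ℚ} → i < d → (∀ j → j < d → j ≢ i → g j ≡ 0ℚ) → sumBelow d g ≡ g i
  sumBelow-single (suc d) zero {g} _ g≡0 rewrite sumBelow-zero d {λ j → g (suc j)} (λ j j<d → g≡0 (suc j) (s≤s j<d) (λ ())) =
    ℚP.+-identityʳ (g 0)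
  sumBelow-single (suc d) (suc i) {g} (s≤s i<d) g≡0 rewrite g≡0 0 (s≤s z≤n) (λ ()) =
    trans (ℚP.+-identityˡ _) (sumBelow-single d i {λ j → g (suc j)} i<d
      (λ j j<d j≢i → g≡0 (suc j) (s≤s j<d) (λ e → j≢i (ℕP.suc-injective e))))

  sumBelow-pair : ∀ d a {g : ℕ → ℚ} → suc a < d → (∀ j → j < d → j ≢ a → j ≢ suc a → g j ≡ 0ℚ) →
    g a + g (suc a) ≡ 0ℚ → sumBelow d g ≡ 0ℚ
  sumBelow-pair (suc (suc d)) zero {g} _ g≡0 pair≡0
    rewrite sumBelow-zero d {λ j → g (suc (suc j))} (λ j j<d → g≡0 (suc (suc j)) (s≤s (s≤s j<d)) (λ ()) (λ ())) =
    trans (sym (ℚP.+-assoc (g 0) (g 1) 0ℚ)) (trans (ℚP.+-identityʳ _) pair≡0)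
  sumBelow-pair (suc d) (suc a) {g} (s≤s a<d) g≡0 pair≡0 rewrite g≡0 0 (s≤s z≤n) (λ ()) (λ ()) =
    trans (ℚP.+-identityˡ _) (sumBelow-pair d a {λ j → g (suc j)} a<d
      (λ j j<d j≢a j≢sa → g≡0 (suc j) (s≤s j<d) (λ e → j≢a (ℕP.suc-injective e)) (λ e → j≢sa (ℕP.suc-injective e)))
      pair≡0)

  punchIn-below : ∀ {j c} → c < j → punchIn j c ≡ c
  punchIn-below {suc j} {zero} _ = refl
  punchIn-below {suc j} {suc c} (s≤s c<j) = cong suc (punchIn-below c<j)

  punchIn-above : ∀ {j c} → j ≤ c → punchIn j c ≡ suc c
  punchIn-above {zero} _ = refl
  punchIn-above {suc j} {suc c} (s≤s j≤c) = cong suc (punchIn-above j≤c)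

  punchIn-< : ∀ {d} j c → c < d → punchIn j c < suc d
  punchIn-< zero c c<d = s≤s c<d
  punchIn-< (suc j) zero _ = s≤s z≤n
  punchIn-< (suc j) (suc c) (s≤s c<d) = s≤s (punchIn-< j c c<d)

  punchIn-≢ : ∀ j c → punchIn j c ≢ j
  punchIn-≢ zero c ()
  punchIn-≢ (suc j) zero ()
  punchIn-≢ (suc j) (suc c) eq = punchIn-≢ j c (ℕP.suc-injective eq)

  punchIn≡⇒≡punchOut : ∀ j i c → punchIn j c ≡ i → c ≡ punchOut j i
  punchIn≡⇒≡punchOut zero _ c refl = refl
  punchIn≡⇒≡punchOut (suc j) _ zero refl = refl
  punchIn≡⇒≡punchOut (suc j) _ (suc c) refl = cong suc (punchIn≡⇒≡punchOut j (punchIn j c) c refl)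

  punchIn-punchOut : ∀ j i → i ≢ j → punchIn j (punchOut j i) ≡ i
  punchIn-punchOut zero zero i≢j = ⊥-elim (i≢j refl)
  punchIn-punchOut zero (suc i) _ = refl
  punchIn-punchOut (suc j) zero _ = refl
  punchIn-punchOut (suc j) (suc i) i≢j = cong suc (punchIn-punchOut j i (λ e → i≢j (cong suc e)))

  punchOut-< : ∀ {d} j i → i < suc d → j < suc d → i ≢ j → punchOut j i < d
  punchOut-< zero zero _ _ i≢j = ⊥-elim (i≢j refl)
  punchOut-< zero (suc i) (s≤s i<d) _ _ = i<d
  punchOut-< {zero} (suc j) i _ (s≤s ()) _
  punchOut-< {suc d} (suc j) zero _ _ _ = s≤s z≤n
  punchOut-< {suc d} (suc j) (suc i) (s≤s i<d) (s≤s j<d) i≢j = s≤s (punchOut-< j i i<d j<d (λ e → i≢j (cong suc e)))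

  punchIn-suc : ∀ a c → c ≢ a → punchIn (suc a) c ≡ punchIn a c
  punchIn-suc zero zero c≢a = ⊥-elim (c≢a refl)
  punchIn-suc zero (suc c) _ = refl
  punchIn-suc (suc a) zero _ = refl
  punchIn-suc (suc a) (suc c) c≢a = cong suc (punchIn-suc a c (λ e → c≢a (cong suc e)))

  detMat-cong : ∀ d (M N : Mat) → (∀ r c → r < d → c < d → M r c ≡ N r c) → detMat d M ≡ detMat d N
  detMat-cong zero M N _ = refl
  detMat-cong (suc d) M N M≡N = sumBelow-cong (suc d) λ j j<d →
    cong₂ (λ a b → signℚ j * a * b) (M≡N 0 j (s≤s z≤n) j<d)
      (detMat-cong d (minor j M) (minor j N) (λ r c r<d c<d → M≡N (suc r) (punchIn j c) (s≤s r<d) (punchIn-< j c c<d)))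

  abstract
    replaceColumn : Mat → ℕ → (ℕ → ℚ) → Mat
    replaceColumn M i w r c with c ℕP.≟ i
    ... | yes _ = w r
    ... | no _ = M r c

    replaceColumn-≡ : ∀ M i w r → replaceColumn M i w r i ≡ w r
    replaceColumn-≡ M i w r with i ℕP.≟ i
    ... | yes _ = refl
    ... | no i≢i = ⊥-elim (i≢i refl)

    replaceColumn-≢ : ∀ M i w r c → c ≢ i → replaceColumn M i w r c ≡ M r c
    replaceColumn-≢ M i w r c c≢i with c ℕP.≟ i
    ... | yes c≡i = ⊥-elim (c≢i c≡i)
    ... | no _ = refl

  replaceColumn-cases : ∀ (P : ℚ → Set) M i w r c → P (w r) → P (M r c) → P (replaceColumn M i w r c)
  replaceColumn-cases P M i w r c Pw PM with c ℕP.≟ i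
  ... | yes refl = subst P (sym (replaceColumn-≡ M c w r)) Pw
  ... | no c≢i = subst P (sym (replaceColumn-≢ M i w r c c≢i)) PM

  replaceColumn-cong : ∀ d M i (w w′ : ℕ → ℚ) → (∀ r → r < d → w r ≡ w′ r) →
    detMat d (replaceColumn M i w) ≡ detMat d (replaceColumn M i w′)
  replaceColumn-cong d M i w w′ w≡w′ = detMat-cong d _ _ λ r c r<d _ → cases r c r<d
    where
    cases : ∀ r c → r < d → replaceColumn M i w r c ≡ replaceColumn M i w′ r c
    cases r c r<d with c ℕP.≟ i
    ... | yes refl = trans (replaceColumn-≡ M c w r) (trans (w≡w′ r r<d) (sym (replaceColumn-≡ M c w′ r)))
    ... | no c≢i = trans (replaceColumn-≢ M i w r c c≢i) (sym (replaceColumn-≢ M i w′ r c c≢i))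

  replaceColumn-self : ∀ d M i → detMat d (replaceColumn M i (λ r → M r i)) ≡ detMat d M
  replaceColumn-self d M i = detMat-cong d _ _ λ r c _ _ → cases r c
    where
    cases : ∀ r c → replaceColumn M i (λ r → M r i) r c ≡ M r c
    cases r c with c ℕP.≟ i
    ... | yes refl = replaceColumn-≡ M c _ r
    ... | no c≢i = replaceColumn-≢ M i _ r c c≢i

  minor-replaceColumn-same : ∀ M i w r c → minor i (replaceColumn M i w) r c ≡ minor i M r c
  minor-replaceColumn-same M i w r c = replaceColumn-≢ M i w (suc r) (punchIn i c) (punchIn-≢ i c)

  minor-replaceColumn : ∀ M i j w → i ≢ j → ∀ r c →
    minor j (replaceColumn M i w) r c ≡ replaceColumn (minor j M) (punchOut j i) (λ r → w (suc r)) r c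
  minor-replaceColumn M i j w i≢j r c with c ℕP.≟ punchOut j i
  ... | yes refl = trans (cong (replaceColumn M i w (suc r)) (punchIn-punchOut j i i≢j))
    (trans (replaceColumn-≡ M i w (suc r)) (sym (replaceColumn-≡ (minor j M) (punchOut j i) (λ r → w (suc r)) r)))
  ... | no c≢ = trans (replaceColumn-≢ M i w (suc r) (punchIn j c) (λ e → c≢ (punchIn≡⇒≡punchOut j i c e)))
    (sym (replaceColumn-≢ (minor j M) (punchOut j i) (λ r → w (suc r)) r c c≢))

  detMat-linear : ∀ d M i → i < d → ∀ s t (u v : ℕ → ℚ) →
    detMat d (replaceColumn M i (λ r → s * u r + t * v r))
      ≡ s * detMat d (replaceColumn M i u) + t * detMat d (replaceColumn M i v)
  detMat-linear (suc d) M i i<d s t u v = trans (sumBelow-cong (suc d) term) (sumBelow-linear (suc d) s t (T u) (T v))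
    where
    T : (ℕ → ℚ) → ℕ → ℚ
    T w j = signℚ j * replaceColumn M i w 0 j * detMat d (minor j (replaceColumn M i w))
    T-same : ∀ w → T w i ≡ signℚ i * w 0 * detMat d (minor i M)
    T-same w = cong₂ (λ a b → signℚ i * a * b) (replaceColumn-≡ M i w 0)
      (detMat-cong d _ _ (λ r c _ _ → minor-replaceColumn-same M i w r c))
    T-other : ∀ j w → j ≢ i → T w j ≡ signℚ j * M 0 j * detMat d (replaceColumn (minor j M) (punchOut j i) (λ r → w (suc r)))
    T-other j w j≢i = cong₂ (λ a b → signℚ j * a * b) (replaceColumn-≢ M i w 0 j j≢i)
      (detMat-cong d _ _ (λ r c _ _ → minor-replaceColumn M i j w (λ e → j≢i (sym e)) r c))
    term : ∀ j → j < suc d → T (λ r → s * u r + t * v r) j ≡ s * T u j + t * T v j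
    term j j<d with j ℕP.≟ i
    ... | yes refl = trans (T-same _) (trans
      (solve 6 (λ g s t a b D → g :* (s :* a :+ t :* b) :* D := s :* (g :* a :* D) :+ t :* (g :* b :* D)) refl
        (signℚ j) s t (u 0) (v 0) (detMat d (minor j M)))
      (sym (cong₂ (λ a b → s * a + t * b) (T-same u) (T-same v))))
    ... | no j≢i = trans (T-other j _ j≢i) (trans (cong (signℚ j * M 0 j *_)
        (detMat-linear d (minor j M) (punchOut j i) (punchOut-< j i i<d j<d (λ e → j≢i (sym e)))
          s t (λ r → u (suc r)) (λ r → v (suc r))))
      (trans (solve 6 (λ g m s t X Y → g :* m :* (s :* X :+ t :* Y) := s :* (g :* m :* X) :+ t :* (g :* m :* Y)) refl (signℚ j) (M 0 j) s t
                (detMat d (replaceColumn (minor j M) (punchOut j i) (λ r → u (suc r))))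
                (detMat d (replaceColumn (minor j M) (punchOut j i) (λ r → v (suc r)))))
      (sym (cong₂ (λ a b → s * a + t * b) (T-other j u j≢i) (T-other j v j≢i)))))

  detMat-additive : ∀ d M i → i < d → ∀ (u v : ℕ → ℚ) →
    detMat d (replaceColumn M i (λ r → u r + v r)) ≡ detMat d (replaceColumn M i u) + detMat d (replaceColumn M i v)
  detMat-additive d M i i<d u v = begin
    detMat d (replaceColumn M i (λ r → u r + v r))             ≡⟨ replaceColumn-cong d M i _ _ (λ r _ → sym (one-one (u r) (v r))) ⟩
    detMat d (replaceColumn M i (λ r → 1ℚ * u r + 1ℚ * v r))   ≡⟨ detMat-linear d M i i<d 1ℚ 1ℚ u v ⟩
    1ℚ * detMat d (replaceColumn M i u) + 1ℚ * detMat d (replaceColumn M i v)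
      ≡⟨ one-one (detMat d (replaceColumn M i u)) (detMat d (replaceColumn M i v)) ⟩
    detMat d (replaceColumn M i u) + detMat d (replaceColumn M i v) ∎
    where
    open ≡-Reasoning
    one-one : ∀ a b → 1ℚ * a + 1ℚ * b ≡ a + b
    one-one a b = solve 2 (λ a b → con 1ℚ :* a :+ con 1ℚ :* b := a :+ b) refl a b

  detMat-homogeneous : ∀ d M i → i < d → ∀ s (u : ℕ → ℚ) →
    detMat d (replaceColumn M i (λ r → s * u r)) ≡ s * detMat d (replaceColumn M i u)
  detMat-homogeneous d M i i<d s u = begin
    detMat d (replaceColumn M i (λ r → s * u r))
      ≡⟨ replaceColumn-cong d M i _ _ (λ r _ → sym (ℚP.+-identityʳ _)) ⟩
    detMat d (replaceColumn M i (λ r → s * u r + 0ℚ))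
      ≡⟨ replaceColumn-cong d M i _ _ (λ r _ → cong (s * u r +_) (sym (ℚP.*-zeroˡ (u r)))) ⟩
    detMat d (replaceColumn M i (λ r → s * u r + 0ℚ * u r))
      ≡⟨ detMat-linear d M i i<d s 0ℚ u u ⟩
    s * detMat d (replaceColumn M i u) + 0ℚ * detMat d (replaceColumn M i u)
      ≡⟨ solve 2 (λ s D → s :* D :+ con 0ℚ :* D := s :* D) refl s (detMat d (replaceColumn M i u)) ⟩
    s * detMat d (replaceColumn M i u) ∎
    where open ≡-Reasoning

  minor-adjacent-left : ∀ M j a → j ≤ a → (∀ r → M r (suc a) ≡ M r (suc (suc a))) →
    ∀ r → minor j M r a ≡ minor j M r (suc a)
  minor-adjacent-left M j a j≤a eq r =
    trans (cong (M (suc r)) (punchIn-above j≤a)) (trans (eq (suc r)) (cong (M (suc r)) (sym (punchIn-above (ℕP.m≤n⇒m≤1+n j≤a)))))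

  minor-adjacent-right : ∀ M j a → suc a < j → (∀ r → M r a ≡ M r (suc a)) →
    ∀ r → minor j M r a ≡ minor j M r (suc a)
  minor-adjacent-right M j a sa<j eq r =
    trans (cong (M (suc r)) (punchIn-below (ℕP.<-trans (ℕP.n<1+n a) sa<j)))
      (trans (eq (suc r)) (cong (M (suc r)) (sym (punchIn-below sa<j))))

  minor-adjacent-same : ∀ M a → (∀ r → M r a ≡ M r (suc a)) → ∀ r c → minor (suc a) M r c ≡ minor a M r c
  minor-adjacent-same M a eq r c with c ℕP.≟ a
  ... | yes refl = trans (cong (M (suc r)) (punchIn-below (ℕP.n<1+n c)))
    (trans (eq (suc r)) (cong (M (suc r)) (sym (punchIn-above ℕP.≤-refl))))
  ... | no c≢a = cong (M (suc r)) (punchIn-suc a c c≢a)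

  -- Every other term of the expansion along row 0 has a minor with two equal adjacent columns,
  -- and the terms for columns a and a + 1 cancel.
  detMat-adjacent : ∀ d M a → suc a < d → (∀ r → M r a ≡ M r (suc a)) → detMat d M ≡ 0ℚ
  detMat-adjacent (suc d) M a sa<d eq = sumBelow-pair (suc d) a sa<d others pair
    where
    g : ℕ → ℚ
    g j = signℚ j * M 0 j * detMat d (minor j M)
    kill : ∀ j → detMat d (minor j M) ≡ 0ℚ → g j ≡ 0ℚ
    kill j D≡0 = trans (cong (signℚ j * M 0 j *_) D≡0) (ℚP.*-zeroʳ (signℚ j * M 0 j))
    below : ∀ j a → j < a → suc a < suc d → (∀ r → M r a ≡ M r (suc a)) → detMat d (minor j M) ≡ 0ℚ
    below j (suc a₀) (s≤s j≤a₀) (s≤s sa₀<d) eq′ =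
      detMat-adjacent d (minor j M) a₀ sa₀<d (minor-adjacent-left M j a₀ j≤a₀ eq′)
    others : ∀ j → j < suc d → j ≢ a → j ≢ suc a → g j ≡ 0ℚ
    others j j<d j≢a j≢sa with ℕP.<-cmp j a
    ... | tri< j<a _ _ = kill j (below j a j<a sa<d eq)
    ... | tri≈ _ j≡a _ = ⊥-elim (j≢a j≡a)
    ... | tri> _ _ a<j = let sa<j = ℕP.≤∧≢⇒< a<j (λ e → j≢sa (sym e)) in
      kill j (detMat-adjacent d (minor j M) a (ℕP.<-≤-trans sa<j (ℕP.≤-pred j<d)) (minor-adjacent-right M j a sa<j eq))
    pair : g a + g (suc a) ≡ 0ℚ
    pair = begin
      signℚ a * M 0 a * detMat d (minor a M) + (- signℚ a) * M 0 (suc a) * detMat d (minor (suc a) M)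
        ≡⟨ cong₂ (λ x y → signℚ a * M 0 a * detMat d (minor a M) + (- signℚ a) * x * y) (sym (eq 0))
             (detMat-cong d _ _ (λ r c _ _ → minor-adjacent-same M a eq r c)) ⟩
      signℚ a * M 0 a * detMat d (minor a M) + (- signℚ a) * M 0 a * detMat d (minor a M)
        ≡⟨ solve 3 (λ s m D → s :* m :* D :+ (:- s) :* m :* D := con 0ℚ) refl (signℚ a) (M 0 a) (detMat d (minor a M)) ⟩
      0ℚ ∎
      where open ≡-Reasoning

  module AdjacentSwap (d : ℕ) (M : Mat) (a : ℕ) (sa<d : suc a < d) where

    column : ℕ → ℕ → ℚ
    column c r = M r c

    with₂ : (ℕ → ℚ) → (ℕ → ℚ) → Mat
    with₂ w₁ w₂ = replaceColumn (replaceColumn M a w₁) (suc a) w₂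

    swapped : Mat
    swapped = with₂ (column (suc a)) (column a)

    private
      a≢sa : a ≢ suc a
      a≢sa ()

      a<d : a < d
      a<d = ℕP.<-trans (ℕP.n<1+n a) sa<d

      with₂-commute : ∀ w₁ w₂ r c → with₂ w₁ w₂ r c ≡ replaceColumn (replaceColumn M (suc a) w₂) a w₁ r c
      with₂-commute w₁ w₂ r c with c ℕP.≟ a | c ℕP.≟ suc a
      ... | yes refl | yes c≡sa = ⊥-elim (a≢sa c≡sa)
      ... | yes refl | no c≢sa = trans (replaceColumn-≢ _ (suc a) w₂ r c c≢sa)
        (trans (replaceColumn-≡ M c w₁ r) (sym (replaceColumn-≡ _ c w₁ r)))
      ... | no c≢a | yes refl = trans (replaceColumn-≡ _ c w₂ r)
        (sym (trans (replaceColumn-≢ _ a w₁ r c c≢a) (replaceColumn-≡ M c w₂ r)))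
      ... | no c≢a | no c≢sa = trans (replaceColumn-≢ _ (suc a) w₂ r c c≢sa) (trans (replaceColumn-≢ M a w₁ r c c≢a)
        (sym (trans (replaceColumn-≢ _ a w₁ r c c≢a) (replaceColumn-≢ M (suc a) w₂ r c c≢sa))))

      with₂-original : ∀ r c → with₂ (column a) (column (suc a)) r c ≡ M r c
      with₂-original r c with c ℕP.≟ suc a
      ... | yes refl = replaceColumn-≡ _ c _ r
      ... | no c≢sa with c ℕP.≟ a
      ...   | yes refl = trans (replaceColumn-≢ _ (suc a) _ r c c≢sa) (replaceColumn-≡ M c _ r)
      ...   | no c≢a = trans (replaceColumn-≢ _ (suc a) _ r c c≢sa) (replaceColumn-≢ M a _ r c c≢a)

      D : (ℕ → ℚ) → (ℕ → ℚ) → ℚ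
      D w₁ w₂ = detMat d (with₂ w₁ w₂)

      D-diagonal : ∀ w → D w w ≡ 0ℚ
      D-diagonal w = detMat-adjacent d (with₂ w w) a sa<d λ r →
        trans (replaceColumn-≢ _ (suc a) w r a a≢sa) (trans (replaceColumn-≡ M a w r) (sym (replaceColumn-≡ _ (suc a) w r)))

      D-additiveʳ : ∀ w₁ u v → D w₁ (λ r → u r + v r) ≡ D w₁ u + D w₁ v
      D-additiveʳ w₁ u v = detMat-additive d (replaceColumn M a w₁) (suc a) sa<d u v

      D-additiveˡ : ∀ u v w₂ → D (λ r → u r + v r) w₂ ≡ D u w₂ + D v w₂
      D-additiveˡ u v w₂ = begin
        D (λ r → u r + v r) w₂ ≡⟨ detMat-cong d _ _ (λ r c _ _ → with₂-commute _ w₂ r c) ⟩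
        detMat d (replaceColumn (replaceColumn M (suc a) w₂) a (λ r → u r + v r))
          ≡⟨ detMat-additive d (replaceColumn M (suc a) w₂) a a<d u v ⟩
        detMat d (replaceColumn (replaceColumn M (suc a) w₂) a u) + detMat d (replaceColumn (replaceColumn M (suc a) w₂) a v)
          ≡⟨ cong₂ _+_ (detMat-cong d _ _ (λ r c _ _ → sym (with₂-commute u w₂ r c)))
                       (detMat-cong d _ _ (λ r c _ _ → sym (with₂-commute v w₂ r c))) ⟩
        D u w₂ + D v w₂ ∎
        where open ≡-Reasoning

    -- Expand D (u + v) (u + v) = 0 bilinearly.
    detMat-swapped : detMat d swapped ≡ - detMat d M
    detMat-swapped = begin
      D v u
        ≡⟨ solve 2 (λ S T → S := :- T :+ ((con 0ℚ :+ S) :+ (T :+ con 0ℚ))) refl (D v u) (D u v) ⟩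
      - D u v + ((0ℚ + D v u) + (D u v + 0ℚ)) ≡⟨ cong (λ z → - D u v + z) (sym expansion) ⟩
      - D u v + 0ℚ                          ≡⟨ ℚP.+-identityʳ _ ⟩
      - D u v                               ≡⟨ cong -_ (detMat-cong d _ _ (λ r c _ _ → with₂-original r c)) ⟩
      - detMat d M                          ∎
      where
      open ≡-Reasoning
      u v : ℕ → ℚ
      u = column a
      v = column (suc a)
      expansion : 0ℚ ≡ (0ℚ + D v u) + (D u v + 0ℚ)
      expansion = begin
        0ℚ                                       ≡⟨ sym (D-diagonal (λ r → u r + v r)) ⟩
        D (λ r → u r + v r) (λ r → u r + v r)    ≡⟨ D-additiveʳ _ u v ⟩
        D (λ r → u r + v r) u + D (λ r → u r + v r) v ≡⟨ cong₂ _+_ (D-additiveˡ u v u) (D-additiveˡ u v v) ⟩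
        (D u u + D v u) + (D u v + D v v)        ≡⟨ cong₂ (λ x y → (x + D v u) + (D u v + y)) (D-diagonal u) (D-diagonal v) ⟩
        (0ℚ + D v u) + (D u v + 0ℚ)              ∎

  -- Move column k + suc m next to column k by adjacent swaps, each of which only flips the sign.
  detMat-equal-columns : ∀ m d M k → k ℕ.+ suc m < d → (∀ r → M r k ≡ M r (k ℕ.+ suc m)) → detMat d M ≡ 0ℚ
  detMat-equal-columns zero d M k k+1<d eq =
    detMat-adjacent d M k (subst (_< d) k+1≡sk k+1<d) (λ r → trans (eq r) (cong (M r) k+1≡sk))
    where
    k+1≡sk : k ℕ.+ 1 ≡ suc k
    k+1≡sk = ℕP.+-comm k 1
  detMat-equal-columns (suc m) d M k k+ssm<d eq = begin
    detMat d M           ≡⟨ solve 1 (λ D → D := :- (:- D)) refl (detMat d M) ⟩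
    - (- detMat d M)     ≡⟨ cong -_ (sym detMat-swapped) ⟩
    - detMat d swapped   ≡⟨ cong -_ (detMat-equal-columns m d swapped k a<d swapped-k≡a) ⟩
    - 0ℚ                 ∎
    where
    open ≡-Reasoning
    a : ℕ
    a = k ℕ.+ suc m
    sa≡ : suc a ≡ k ℕ.+ suc (suc m)
    sa≡ = sym (ℕP.+-suc k (suc m))
    sa<d : suc a < d
    sa<d = subst (_< d) (sym sa≡) k+ssm<d
    open AdjacentSwap d M a sa<d using (swapped; detMat-swapped)
    a<d : a < d
    a<d = ℕP.<-trans (ℕP.n<1+n a) sa<d
    k<a : k < a
    k<a = ℕP.m<m+n k (s≤s z≤n)
    swapped-k≡a : ∀ r → swapped r k ≡ swapped r a
    swapped-k≡a r = trans (replaceColumn-≢ _ (suc a) _ r k (λ e → ℕP.<-irrefl e (ℕP.<-trans k<a (ℕP.n<1+n a))))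
      (trans (replaceColumn-≢ M a _ r k (ℕP.<⇒≢ k<a))
      (trans (eq r) (trans (cong (M r) (sym sa≡))
        (sym (trans (replaceColumn-≢ _ (suc a) _ r a (ℕP.<⇒≢ (ℕP.n<1+n a))) (replaceColumn-≡ M a _ r))))))

  detMat-repeated-column : ∀ d M k l → k ≢ l → k < d → l < d → (∀ r → M r k ≡ M r l) → detMat d M ≡ 0ℚ
  detMat-repeated-column d M k l k≢l k<d l<d eq with ℕP.<-cmp k l
  ... | tri≈ _ k≡l _ = ⊥-elim (k≢l k≡l)
  ... | tri< k<l _ _ =
    detMat-equal-columns (l ℕ.∸ suc k) d M k (subst (_< d) (sym dist) l<d) (λ r → trans (eq r) (cong (M r) (sym dist)))
    where
    dist : k ℕ.+ suc (l ℕ.∸ suc k) ≡ l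
    dist = trans (ℕP.+-suc k _) (ℕP.m+[n∸m]≡n k<l)
  ... | tri> _ _ l<k =
    detMat-equal-columns (k ℕ.∸ suc l) d M l (subst (_< d) (sym dist) k<d) (λ r → trans (sym (eq r)) (cong (M r) (sym dist)))
    where
    dist : l ℕ.+ suc (k ℕ.∸ suc l) ≡ k
    dist = trans (ℕP.+-suc l _) (ℕP.m+[n∸m]≡n l<k)

  detMat-sum : ∀ d M i → i < d → ∀ m (f : ℕ → ℕ → ℚ) →
    detMat d (replaceColumn M i (λ r → sumBelow m (λ c → f c r))) ≡ sumBelow m (λ c → detMat d (replaceColumn M i (f c)))
  detMat-sum d M i i<d zero f = begin
    detMat d (replaceColumn M i (λ r → 0ℚ))        ≡⟨ replaceColumn-cong d M i _ _ (λ r _ → sym (ℚP.*-zeroˡ 0ℚ)) ⟩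
    detMat d (replaceColumn M i (λ r → 0ℚ * 0ℚ))   ≡⟨ detMat-homogeneous d M i i<d 0ℚ (λ _ → 0ℚ) ⟩
    0ℚ * detMat d (replaceColumn M i (λ r → 0ℚ))   ≡⟨ ℚP.*-zeroˡ (detMat d (replaceColumn M i (λ r → 0ℚ))) ⟩
    0ℚ ∎
    where open ≡-Reasoning
  detMat-sum d M i i<d (suc m) f =
    trans (detMat-additive d M i i<d (f 0) (λ r → sumBelow m (λ c → f (suc c) r)))
      (cong (detMat d (replaceColumn M i (f 0)) +_) (detMat-sum d M i i<d m (λ c → f (suc c))))

  cramer : ∀ d M i → i < d → ∀ (x : ℕ → ℚ) →
    detMat d (replaceColumn M i (λ r → sumBelow d (λ c → M r c * x c))) ≡ x i * detMat d M
  cramer d M i i<d x = begin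
    detMat d (replaceColumn M i (λ r → sumBelow d (λ c → M r c * x c)))
      ≡⟨ detMat-sum d M i i<d d (λ c r → M r c * x c) ⟩
    sumBelow d (λ c → detMat d (replaceColumn M i (λ r → M r c * x c)))
      ≡⟨ sumBelow-cong d (λ c _ → trans (replaceColumn-cong d M i _ _ (λ r _ → ℚP.*-comm (M r c) (x c)))
                                        (detMat-homogeneous d M i i<d (x c) (λ r → M r c))) ⟩
    sumBelow d (λ c → x c * detMat d (replaceColumn M i (λ r → M r c)))
      ≡⟨ sumBelow-single d i i<d repeated ⟩
    x i * detMat d (replaceColumn M i (λ r → M r i))
      ≡⟨ cong (x i *_) (replaceColumn-self d M i) ⟩
    x i * detMat d M ∎
    where
    open ≡-Reasoning
    repeated : ∀ c → c < d → c ≢ i → x c * detMat d (replaceColumn M i (λ r → M r c)) ≡ 0ℚ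
    repeated c c<d c≢i = trans (cong (x c *_)
      (detMat-repeated-column d (replaceColumn M i (λ r → M r c)) i c (λ e → c≢i (sym e)) i<d c<d
        (λ r → trans (replaceColumn-≡ M i _ r) (sym (replaceColumn-≢ M i _ r c c≢i))))) (ℚP.*-zeroʳ (x c))


module MatrixBridge where

  open import Defs
  open IntegerEmbedding
  open Determinant
  open import Data.Nat using (ℕ; zero; suc; z≤n; s≤s; _<_)
  open import Data.Integer as ℤ using (ℤ; +_)
  open import Data.Rational using (ℚ; 0ℚ; 1ℚ; _+_; _*_; -_)
  import Data.Rational.Properties as ℚP
  open import Data.Fin using (Fin; zero; suc; toℕ)
  open import Data.Vec as V using (Vec; []; _∷_)
  open import Data.Product using (Σ; ∃; _,_)
  open import Relation.Binary.PropositionalEquality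

  lookupOr : ∀ {A : Set} {d} → A → Vec A d → ℕ → A
  lookupOr x [] _ = x
  lookupOr x (a ∷ as) zero = a
  lookupOr x (a ∷ as) (suc k) = lookupOr x as k

  lookupOr-lookup : ∀ {A : Set} {d} (x : A) (v : Vec A d) j → lookupOr x v (toℕ j) ≡ V.lookup v j
  lookupOr-lookup x (a ∷ v) zero = refl
  lookupOr-lookup x (a ∷ v) (suc j) = lookupOr-lookup x v j

  lookupOr-map : ∀ {A B : Set} {d} (f : A → B) x (v : Vec A d) r → lookupOr (f x) (V.map f v) r ≡ f (lookupOr x v r)
  lookupOr-map f x [] r = refl
  lookupOr-map f x (a ∷ v) zero = refl
  lookupOr-map f x (a ∷ v) (suc r) = lookupOr-map f x v r

  lookupOr-map-< : ∀ {A B : Set} {d} (f : A → B) x y (v : Vec A d) r → r < d → lookupOr y (V.map f v) r ≡ f (lookupOr x v r)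
  lookupOr-map-< f x y (a ∷ v) zero _ = refl
  lookupOr-map-< f x y (a ∷ v) (suc r) (s≤s r<d) = lookupOr-map-< f x y v r r<d

  lookupOr-removeAt : ∀ {A : Set} {d} (x : A) (v : Vec A (suc d)) j c →
    lookupOr x (V.removeAt v j) c ≡ lookupOr x v (punchIn (toℕ j) c)
  lookupOr-removeAt x (a ∷ v) zero c = refl
  lookupOr-removeAt x (a ∷ b ∷ v) (suc j) zero = refl
  lookupOr-removeAt x (a ∷ b ∷ v) (suc j) (suc c) = lookupOr-removeAt x (b ∷ v) j c

  Vec-ext : ∀ {A : Set} {d} (x : A) (v w : Vec A d) → (∀ i → i < d → lookupOr x v i ≡ lookupOr x w i) → v ≡ w
  Vec-ext x [] [] _ = refl
  Vec-ext x (a ∷ v) (b ∷ w) eq = cong₂ _∷_ (eq 0 (s≤s z≤n)) (Vec-ext x v w (λ i i<d → eq (suc i) (s≤s i<d)))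

  toMat : ∀ {d} → Matrix d → Mat
  toMat {d} A r c = toℚ (lookupOr (+ 0) (lookupOr (V.replicate d (+ 0)) A r) c)

  toℚ-sign : ∀ k → toℚ (sign k) ≡ signℚ k
  toℚ-sign zero = refl
  toℚ-sign (suc k) = trans (toℚ-neg (sign k)) (cong -_ (toℚ-sign k))

  toℚ-sum-tabulate : ∀ {d} (g : Fin d → ℤ) (h : ℕ → ℚ) → (∀ j → toℚ (g j) ≡ h (toℕ j)) →
    toℚ (V.foldr _ ℤ._+_ (+ 0) (V.tabulate g)) ≡ sumBelow d h
  toℚ-sum-tabulate {zero} g h eq = refl
  toℚ-sum-tabulate {suc d} g h eq =
    trans (toℚ-+ (g zero) _) (cong₂ _+_ (eq zero) (toℚ-sum-tabulate (λ j → g (suc j)) (λ j → h (suc j)) (λ j → eq (suc j))))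

  det≡detMat : ∀ {d} (A : Matrix d) → toℚ (det A) ≡ detMat d (toMat A)
  det≡detMat {zero} [] = refl
  det≡detMat {suc d} (row ∷ rows) =
    toℚ-sum-tabulate (λ j → sign (toℕ j) ℤ.* V.lookup row j ℤ.* det (minorᵥ j))
      (λ j → signℚ j * toMat (row ∷ rows) 0 j * detMat d (minor j (toMat (row ∷ rows)))) term
    where
    minorᵥ : Fin (suc d) → Matrix d
    minorᵥ j = V.map (λ r → V.removeAt r j) rows
    term : ∀ j → toℚ (sign (toℕ j) ℤ.* V.lookup row j ℤ.* det (minorᵥ j))
               ≡ signℚ (toℕ j) * toMat (row ∷ rows) 0 (toℕ j) * detMat d (minor (toℕ j) (toMat (row ∷ rows)))
    term j = trans (toℚ-* (sign (toℕ j) ℤ.* V.lookup row j) (det (minorᵥ j)))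
      (cong₂ _*_ (trans (toℚ-* (sign (toℕ j)) (V.lookup row j))
                        (cong₂ _*_ (toℚ-sign (toℕ j)) (cong toℚ (sym (lookupOr-lookup (+ 0) row j)))))
                 (trans (det≡detMat (minorᵥ j)) (detMat-cong d _ _ entries)))
      where
      entries : ∀ r c → r < d → c < d → toMat (minorᵥ j) r c ≡ minor (toℕ j) (toMat (row ∷ rows)) r c
      entries r c r<d _ = cong toℚ (trans
        (cong (λ v → lookupOr (+ 0) v c)
          (lookupOr-map-< (λ r → V.removeAt r j) (V.replicate (suc d) (+ 0)) (V.replicate d (+ 0)) rows r r<d))
        (lookupOr-removeAt (+ 0) (lookupOr (V.replicate (suc d) (+ 0)) rows r) j c))

  IsInteger : ℚ → Set
  IsInteger q = ∃ λ z → q ≡ toℚ z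

  IsInteger-+ : ∀ {p q} → IsInteger p → IsInteger q → IsInteger (p + q)
  IsInteger-+ (z , p≡z) (w , q≡w) = z ℤ.+ w , trans (cong₂ _+_ p≡z q≡w) (sym (toℚ-+ z w))

  IsInteger-* : ∀ {p q} → IsInteger p → IsInteger q → IsInteger (p * q)
  IsInteger-* (z , p≡z) (w , q≡w) = z ℤ.* w , trans (cong₂ _*_ p≡z q≡w) (sym (toℚ-* z w))

  sumBelow-integer : ∀ d (g : ℕ → ℚ) → (∀ j → j < d → IsInteger (g j)) → IsInteger (sumBelow d g)
  sumBelow-integer zero g _ = + 0 , refl
  sumBelow-integer (suc d) g int =
    IsInteger-+ (int 0 (s≤s z≤n)) (sumBelow-integer d (λ j → g (suc j)) (λ j j<d → int (suc j) (s≤s j<d)))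

  detMat-integer : ∀ d M → (∀ r c → r < d → c < d → IsInteger (M r c)) → IsInteger (detMat d M)
  detMat-integer zero M _ = + 1 , refl
  detMat-integer (suc d) M int = sumBelow-integer (suc d) _ λ j j<d →
    IsInteger-* (IsInteger-* (sign j , sym (toℚ-sign j)) (int 0 j (s≤s z≤n) j<d))
      (detMat-integer d (minor j M) (λ r c r<d c<d → int (suc r) (punchIn j c) (s≤s r<d) (punchIn-< j c c<d)))

  integerVec : ∀ {d} (x : QPoint d) → (∀ i → i < d → IsInteger (lookupOr 0ℚ x i)) → Σ (Point d) λ a → x ≡ embed a
  integerVec [] _ = [] , refl
  integerVec (q ∷ x) int =
    let (z , q≡z) = int 0 (s≤s z≤n)
        (a , x≡a) = integerVec x (λ i i<d → int (suc i) (s≤s i<d))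
    in z ∷ a , cong₂ _∷_ q≡z x≡a

  dotᵥ : ∀ {d} → QPoint d → QPoint d → ℚ
  dotᵥ u v = V.foldr _ _+_ 0ℚ (V.zipWith _*_ u v)

  mulQ : ∀ {d e} → Vec (Vec ℤ d) e → QPoint d → QPoint e
  mulQ A x = V.map (λ row → dotᵥ (embed row) x) A

  dotᵥ-sumBelow : ∀ {d} (u v : QPoint d) → dotᵥ u v ≡ sumBelow d (λ c → lookupOr 0ℚ u c * lookupOr 0ℚ v c)
  dotᵥ-sumBelow [] [] = refl
  dotᵥ-sumBelow (a ∷ u) (b ∷ v) = cong (_+_ (a * b)) (dotᵥ-sumBelow u v)

  lookupOr-mulQ : ∀ {d} (A : Matrix d) x r → r < d → lookupOr 0ℚ (mulQ A x) r ≡ sumBelow d (λ c → toMat A r c * lookupOr 0ℚ x c)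
  lookupOr-mulQ {d} A x r r<d = trans (lookupOr-map-< (λ row → dotᵥ (embed row) x) (V.replicate d (+ 0)) 0ℚ A r r<d)
    (trans (dotᵥ-sumBelow (embed (lookupOr (V.replicate d (+ 0)) A r)) x)
      (sumBelow-cong d (λ c _ → cong (_* lookupOr 0ℚ x c) (lookupOr-map toℚ (+ 0) (lookupOr (V.replicate d (+ 0)) A r) c))))

  module Unimodular {d} (A : Matrix d) (det≡1 : det A ≡ + 1) where

    detMat≡1 : detMat d (toMat A) ≡ 1ℚ
    detMat≡1 = trans (sym (det≡detMat A)) (cong toℚ det≡1)

    cramer-unimodular : ∀ x i → i < d → lookupOr 0ℚ x i ≡ detMat d (replaceColumn (toMat A) i (λ r → lookupOr 0ℚ (mulQ A x) r))
    cramer-unimodular x i i<d = begin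
      lookupOr 0ℚ x i                        ≡⟨ ℚP.*-identityʳ _ ⟨
      lookupOr 0ℚ x i * 1ℚ                   ≡⟨ cong (lookupOr 0ℚ x i *_) detMat≡1 ⟨
      lookupOr 0ℚ x i * detMat d (toMat A)   ≡⟨ cramer d (toMat A) i i<d (lookupOr 0ℚ x) ⟨
      detMat d (replaceColumn (toMat A) i (λ r → sumBelow d (λ c → toMat A r c * lookupOr 0ℚ x c)))
        ≡⟨ replaceColumn-cong d (toMat A) i _ _ (λ r r<d → sym (lookupOr-mulQ A x r r<d)) ⟩
      detMat d (replaceColumn (toMat A) i (λ r → lookupOr 0ℚ (mulQ A x) r)) ∎
      where open ≡-Reasoning

    mulQ-injective : ∀ x y → mulQ A x ≡ mulQ A y → x ≡ y
    mulQ-injective x y Ax≡Ay = Vec-ext 0ℚ x y λ i i<d →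
      trans (cramer-unimodular x i i<d)
        (trans (cong (λ v → detMat d (replaceColumn (toMat A) i (λ r → lookupOr 0ℚ v r))) Ax≡Ay) (sym (cramer-unimodular y i i<d)))

    mulQ-integral : ∀ x (z : Point d) → mulQ A x ≡ embed z → Σ (Point d) λ a → x ≡ embed a
    mulQ-integral x z Ax≡z = integerVec x λ i i<d → subst IsInteger (sym (cramer-unimodular x i i<d))
      (detMat-integer d _ λ r c r<d c<d → replaceColumn-cases IsInteger (toMat A) i _ r c
        (subst IsInteger (sym (trans (cong (λ v → lookupOr 0ℚ v r) Ax≡z) (lookupOr-map toℚ (+ 0) z r))) (lookupOr (+ 0) z r , refl))
        (lookupOr (+ 0) (lookupOr (V.replicate d (+ 0)) A r) c , refl))


module AffineImage where

  open import Defs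
  open IntegerEmbedding
  open MatrixBridge
  open ConvexHull using (sumℚ)
  open import Data.Nat using (ℕ)
  import Data.Nat.Properties as ℕP
  open import Data.Integer as ℤ using (ℤ; +_)
  open import Data.Rational using (0ℚ; 1ℚ; _+_; _*_; _-_; -_)
  import Data.Rational.Properties as ℚP
  open import Data.Rational.Solver using (module +-*-Solver)
  open import Data.Vec as V using (Vec; []; _∷_)
  import Data.Vec.Properties as VP
  open import Data.List as L using (List; []; _∷_; length)
  import Data.List.Properties as LP
  open import Data.Product using (Σ; _×_; _,_)
  open import Relation.Binary.PropositionalEquality
  open +-*-Solver using (solve; _:=_; _:+_; _:-_; _:*_; :-_; con)

  rowZ : ∀ {d} → Vec ℤ d → Vec ℤ d → ℤ
  rowZ row x = V.foldr _ ℤ._+_ (+ 0) (V.zipWith ℤ._*_ row x)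

  mulZ : ∀ {d e} → Vec (Vec ℤ d) e → Point d → Point e
  mulZ A x = V.map (λ row → rowZ row x) A

  affQ : ∀ {d} → Matrix d → Point d → QPoint d → QPoint d
  affQ A b y = mulQ A y +ᵥ embed b

  _*ᵥ_ : ∀ {d} → ℕ → Point d → Point d
  n *ᵥ b = V.map (+ n ℤ.*_) b

  embed-mulZ : ∀ {d e} (A : Vec (Vec ℤ d) e) x → embed (mulZ A x) ≡ mulQ A (embed x)
  embed-mulZ [] x = refl
  embed-mulZ (row ∷ A) x = cong₂ _∷_ (embed-rowZ row x) (embed-mulZ A x)
    where
    embed-rowZ : ∀ {d} (row x : Vec ℤ d) → toℚ (rowZ row x) ≡ dotᵥ (embed row) (embed x)
    embed-rowZ [] [] = refl
    embed-rowZ (a ∷ row) (z ∷ x) = trans (toℚ-+ (a ℤ.* z) (rowZ row x)) (cong₂ _+_ (toℚ-* a z) (embed-rowZ row x))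

  embed-+ : ∀ {d} (u v : Point d) → embed (V.zipWith ℤ._+_ u v) ≡ embed u +ᵥ embed v
  embed-+ [] [] = refl
  embed-+ (a ∷ u) (b ∷ v) = cong₂ _∷_ (toℚ-+ a b) (embed-+ u v)

  embed-*ᵥ : ∀ {d} n (b : Point d) → embed (n *ᵥ b) ≡ toℚ (+ n) ·ᵥ embed b
  embed-*ᵥ n [] = refl
  embed-*ᵥ n (z ∷ b) = cong₂ _∷_ (toℚ-* (+ n) z) (embed-*ᵥ n b)

  embed-applyAff : ∀ {d} (A : Matrix d) b x → embed (applyAff A b x) ≡ affQ A b (embed x)
  embed-applyAff A b x = trans (embed-+ (mulZ A x) b) (cong (_+ᵥ embed b) (embed-mulZ A x))

  +ᵥ-identityʳ : ∀ {d} (x : QPoint d) → x +ᵥ zeroᵥ ≡ x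
  +ᵥ-identityʳ [] = refl
  +ᵥ-identityʳ (a ∷ x) = cong₂ _∷_ (ℚP.+-identityʳ a) (+ᵥ-identityʳ x)

  ·ᵥ-identityˡ : ∀ {d} (x : QPoint d) → 1ℚ ·ᵥ x ≡ x
  ·ᵥ-identityˡ [] = refl
  ·ᵥ-identityˡ (a ∷ x) = cong₂ _∷_ (ℚP.*-identityˡ a) (·ᵥ-identityˡ x)

  ·ᵥ-distribˡ-+ᵥ : ∀ {d} c (u v : QPoint d) → c ·ᵥ (u +ᵥ v) ≡ (c ·ᵥ u) +ᵥ (c ·ᵥ v)
  ·ᵥ-distribˡ-+ᵥ c [] [] = refl
  ·ᵥ-distribˡ-+ᵥ c (u ∷ us) (v ∷ vs) = cong₂ _∷_ (ℚP.*-distribˡ-+ c u v) (·ᵥ-distribˡ-+ᵥ c us vs)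

  mulQ-linear : ∀ {d e} (A : Vec (Vec ℤ d) e) c x y → mulQ A ((c ·ᵥ x) +ᵥ y) ≡ (c ·ᵥ mulQ A x) +ᵥ mulQ A y
  mulQ-linear [] c x y = refl
  mulQ-linear (row ∷ A) c x y = cong₂ _∷_ (dotᵥ-linear (embed row) x y) (mulQ-linear A c x y)
    where
    dotᵥ-linear : ∀ {d} (u x y : QPoint d) → dotᵥ u ((c ·ᵥ x) +ᵥ y) ≡ c * dotᵥ u x + dotᵥ u y
    dotᵥ-linear [] [] [] = solve 1 (λ c → con 0ℚ := c :* con 0ℚ :+ con 0ℚ) refl c
    dotᵥ-linear (a ∷ u) (x ∷ xs) (y ∷ ys) rewrite dotᵥ-linear u xs ys =
      solve 6 (λ a c x y P Q → a :* (c :* x :+ y) :+ (c :* P :+ Q) := c :* (a :* x :+ P) :+ (a :* y :+ Q)) refl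
        a c x y (dotᵥ u xs) (dotᵥ u ys)

  mulQ-zero : ∀ {d e} (A : Vec (Vec ℤ d) e) → mulQ A zeroᵥ ≡ zeroᵥ
  mulQ-zero [] = refl
  mulQ-zero (row ∷ A) = cong₂ _∷_ (dotᵥ-zero (embed row)) (mulQ-zero A)
    where
    dotᵥ-zero : ∀ {d} (u : QPoint d) → dotᵥ u zeroᵥ ≡ 0ℚ
    dotᵥ-zero [] = refl
    dotᵥ-zero (a ∷ u) rewrite dotᵥ-zero u = solve 1 (λ a → a :* con 0ℚ :+ con 0ℚ := con 0ℚ) refl a

  mulQ-·ᵥ : ∀ {d} (A : Matrix d) c x → mulQ A (c ·ᵥ x) ≡ c ·ᵥ mulQ A x
  mulQ-·ᵥ A c x = begin
    mulQ A (c ·ᵥ x)                    ≡⟨ cong (mulQ A) (+ᵥ-identityʳ (c ·ᵥ x)) ⟨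
    mulQ A ((c ·ᵥ x) +ᵥ zeroᵥ)         ≡⟨ mulQ-linear A c x zeroᵥ ⟩
    (c ·ᵥ mulQ A x) +ᵥ mulQ A zeroᵥ    ≡⟨ cong ((c ·ᵥ mulQ A x) +ᵥ_) (mulQ-zero A) ⟩
    (c ·ᵥ mulQ A x) +ᵥ zeroᵥ           ≡⟨ +ᵥ-identityʳ _ ⟩
    c ·ᵥ mulQ A x                      ∎
    where open ≡-Reasoning

  combo-image : ∀ {d} (A : Matrix d) b lam (P : List (Point d)) → length lam ≡ length P →
    combo lam (L.map (applyAff A b) P) ≡ mulQ A (combo lam P) +ᵥ (sumℚ lam ·ᵥ embed b)
  combo-image A b [] [] _ = trans (zero≡ (embed b)) (cong (_+ᵥ (0ℚ ·ᵥ embed b)) (sym (mulQ-zero A)))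
    where
    zero≡ : ∀ {d} (e : QPoint d) → zeroᵥ ≡ zeroᵥ +ᵥ (0ℚ ·ᵥ e)
    zero≡ [] = refl
    zero≡ (e ∷ es) = cong₂ _∷_ (solve 1 (λ e → con 0ℚ := con 0ℚ :+ con 0ℚ :* e) refl e) (zero≡ es)
  combo-image A b (l ∷ lam) (v ∷ P) len = begin
    (l ·ᵥ embed (applyAff A b v)) +ᵥ combo lam (L.map (applyAff A b) P)
      ≡⟨ cong₂ (λ X Y → (l ·ᵥ X) +ᵥ Y) (embed-applyAff A b v) (combo-image A b lam P (ℕP.suc-injective len)) ⟩
    (l ·ᵥ (mulQ A (embed v) +ᵥ embed b)) +ᵥ (mulQ A (combo lam P) +ᵥ (sumℚ lam ·ᵥ embed b))
      ≡⟨ regroup l (sumℚ lam) _ _ _ ⟩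
    ((l ·ᵥ mulQ A (embed v)) +ᵥ mulQ A (combo lam P)) +ᵥ ((l + sumℚ lam) ·ᵥ embed b)
      ≡⟨ cong (_+ᵥ ((l + sumℚ lam) ·ᵥ embed b)) (mulQ-linear A l (embed v) (combo lam P)) ⟨
    mulQ A ((l ·ᵥ embed v) +ᵥ combo lam P) +ᵥ ((l + sumℚ lam) ·ᵥ embed b) ∎
    where
    open ≡-Reasoning
    regroup : ∀ {d} l s (p e q : QPoint d) → (l ·ᵥ (p +ᵥ e)) +ᵥ (q +ᵥ (s ·ᵥ e)) ≡ ((l ·ᵥ p) +ᵥ q) +ᵥ ((l + s) ·ᵥ e)
    regroup l s [] [] [] = refl
    regroup l s (p ∷ ps) (e ∷ es) (q ∷ qs) = cong₂ _∷_
      (solve 5 (λ l s p e q → l :* (p :+ e) :+ (q :+ s :* e) := l :* p :+ q :+ (l :+ s) :* e) refl l s p e q) (regroup l s ps es qs)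

  InPoly-image : ∀ {d} (A : Matrix d) b (P : LatticePolytope d) p → InPoly P p → InPoly (imageP A b P) (affQ A b p)
  InPoly-image A b P p (lam , len , nonneg , sum≡1 , combo≡p) =
    lam , trans len (sym (LP.length-map _ P)) , nonneg , sum≡1 ,
    trans (combo-image A b lam P len)
      (cong₂ (λ X Y → mulQ A X +ᵥ Y) combo≡p (trans (cong (_·ᵥ embed b) sum≡1) (·ᵥ-identityˡ (embed b))))

  InPoly-image⁻ : ∀ {d} (A : Matrix d) b (P : LatticePolytope d) q → InPoly (imageP A b P) q →
    Σ (QPoint d) λ p → InPoly P p × q ≡ affQ A b p
  InPoly-image⁻ A b P q (lam , len , nonneg , sum≡1 , combo≡q) =
    combo lam P , (lam , len′ , nonneg , sum≡1 , refl) ,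
    trans (sym combo≡q) (trans (combo-image A b lam P len′)
      (cong (mulQ A (combo lam P) +ᵥ_) (trans (cong (_·ᵥ embed b) sum≡1) (·ᵥ-identityˡ (embed b)))))
    where len′ = trans len (LP.length-map _ P)

  ·ᵥ-affQ : ∀ {d} (A : Matrix d) n b p → toℚ (+ n) ·ᵥ affQ A b p ≡ affQ A (n *ᵥ b) (toℚ (+ n) ·ᵥ p)
  ·ᵥ-affQ A n b p = trans (·ᵥ-distribˡ-+ᵥ (toℚ (+ n)) (mulQ A p) (embed b))
    (cong₂ _+ᵥ_ (sym (mulQ-·ᵥ A (toℚ (+ n)) p)) (sym (embed-*ᵥ n b)))

  +ᵥ-cancelʳ : ∀ {d} (u v e : QPoint d) → u +ᵥ e ≡ v +ᵥ e → u ≡ v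
  +ᵥ-cancelʳ [] [] [] _ = refl
  +ᵥ-cancelʳ (u ∷ us) (v ∷ vs) (e ∷ es) eq = cong₂ _∷_
    (trans (solve 2 (λ u e → u := (u :+ e) :- e) refl u e)
      (trans (cong (_- e) (VP.∷-injectiveˡ eq)) (solve 2 (λ v e → (v :+ e) :- e := v) refl v e)))
    (+ᵥ-cancelʳ us vs es (VP.∷-injectiveʳ eq))

  _-ᵥ_ : ∀ {d} → Point d → Point d → Point d
  _-ᵥ_ = V.zipWith (λ a b → a ℤ.- b)

  u+e≡z⇒u≡z-e : ∀ {d} (u : QPoint d) (e z : Point d) → u +ᵥ embed e ≡ embed z → u ≡ embed (z -ᵥ e)
  u+e≡z⇒u≡z-e [] [] [] _ = refl
  u+e≡z⇒u≡z-e (u ∷ us) (e ∷ es) (z ∷ zs) eq = cong₂ _∷_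
    (trans (solve 2 (λ u e → u := (u :+ e) :+ (:- e)) refl u (toℚ e))
      (trans (cong (λ q → q + - toℚ e) (VP.∷-injectiveˡ eq))
        (trans (cong (_+_ (toℚ z)) (sym (toℚ-neg e))) (sym (toℚ-+ z (ℤ.- e))))))
    (u+e≡z⇒u≡z-e us es zs (VP.∷-injectiveʳ eq))

  module UnimodularAffine {d} (A : Matrix d) (det≡1 : det A ≡ + 1) where
    open Unimodular A det≡1

    affQ-injective : ∀ b x y → affQ A b x ≡ affQ A b y → x ≡ y
    affQ-injective b x y eq = mulQ-injective x y (+ᵥ-cancelʳ (mulQ A x) (mulQ A y) (embed b) eq)

    affQ-integral : ∀ b x (z : Point d) → affQ A b x ≡ embed z → Σ (Point d) λ a → x ≡ embed a
    affQ-integral b x z eq = mulQ-integral x (z -ᵥ b) (u+e≡z⇒u≡z-e (mulQ A x) b z eq)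

    applyAff-injective : ∀ b {x y} → applyAff A b x ≡ applyAff A b y → x ≡ y
    applyAff-injective b {x} {y} eq = embed-injective x y
      (affQ-injective b (embed x) (embed y) (trans (sym (embed-applyAff A b x)) (trans (cong embed eq) (embed-applyAff A b y))))


module GcdInvariance where

  open import Defs
  open IntegerEmbedding
  open MatrixBridge using (mulQ; module Unimodular)
  open AffineImage
  open import Data.Nat using (ℕ; zero; suc)
  import Data.Nat.Properties as ℕP
  import Data.Nat.Divisibility as ℕ∣
  open import Data.Nat.GCD using (gcd; gcd[m,n]∣m; gcd[m,n]∣n; gcd-greatest)
  open import Data.Integer as ℤ using (ℤ; +_; ∣_∣)
  import Data.Integer.Properties as ℤP
  open import Data.Integer.Divisibility.Signed
    using (_∣_; divides; ∣⇒∣ᵤ; ∣ᵤ⇒∣; ∣m∣n⇒∣m+n; ∣n⇒∣m*n; ∣m+n∣n⇒∣m)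
  open import Data.Vec as V using (Vec; []; _∷_)
  import Data.Vec.Relation.Unary.All as VA
  open import Data.Product using (Σ; _×_; _,_; proj₁; proj₂)
  open import Data.Empty using (⊥-elim)
  open import Function.Bundles using (_⇔_; mk⇔; Equivalence)
  open import Relation.Binary.PropositionalEquality
  open Equivalence

  infix 4 _∣ᵥ_

  _∣ᵥ_ : ∀ {d} → ℤ → Point d → Set
  k ∣ᵥ a = VA.All (k ∣_) a

  gcdWith : ∀ {d} → ℕ → Point d → ℕ
  gcdWith n a = V.foldr _ (λ z g → gcd ∣ z ∣ g) n a

  ∣gcdWith⇔ : ∀ {d} k n (a : Point d) → k ℕ∣.∣ gcdWith n a ⇔ (k ℕ∣.∣ n × + k ∣ᵥ a)
  ∣gcdWith⇔ k n [] = mk⇔ (λ k∣n → k∣n , VA.[]) proj₁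
  ∣gcdWith⇔ k n (z ∷ a) = mk⇔
    (λ k∣g → let (k∣n , k∣a) = to (∣gcdWith⇔ k n a) (ℕ∣.∣-trans k∣g (gcd[m,n]∣n ∣ z ∣ (gcdWith n a))) in
      k∣n , ∣ᵤ⇒∣ (ℕ∣.∣-trans k∣g (gcd[m,n]∣m ∣ z ∣ (gcdWith n a))) VA.∷ k∣a)
    (λ { (k∣n , k∣z VA.∷ k∣a) → gcd-greatest (∣⇒∣ᵤ k∣z) (from (∣gcdWith⇔ k n a) (k∣n , k∣a)) })

  same-divisors⇒≡ : ∀ x y → (∀ k → k ℕ∣.∣ x ⇔ k ℕ∣.∣ y) → x ≡ y
  same-divisors⇒≡ x y same = ℕ∣.∣-antisym (to (same x) ℕ∣.∣-refl) (from (same y) ℕ∣.∣-refl)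

  ∣ᵥ-mulZ : ∀ {d e} k (A : Vec (Vec ℤ d) e) a → k ∣ᵥ a → k ∣ᵥ mulZ A a
  ∣ᵥ-mulZ k [] a _ = VA.[]
  ∣ᵥ-mulZ k (row ∷ A) a k∣a = ∣-rowZ row a k∣a VA.∷ ∣ᵥ-mulZ k A a k∣a
    where
    ∣-rowZ : ∀ {d} (row a : Vec ℤ d) → k ∣ᵥ a → k ∣ rowZ row a
    ∣-rowZ [] [] VA.[] = divides (+ 0) refl
    ∣-rowZ (c ∷ row) (z ∷ a) (k∣z VA.∷ k∣a) = ∣m∣n⇒∣m+n (∣n⇒∣m*n c k∣z) (∣-rowZ row a k∣a)

  ∣ᵥ-*ᵥ : ∀ {d} k n (b : Point d) → k ∣ + n → k ∣ᵥ (n *ᵥ b)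
  ∣ᵥ-*ᵥ k n [] _ = VA.[]
  ∣ᵥ-*ᵥ k n (z ∷ b) k∣n = subst (k ∣_) (ℤP.*-comm z (+ n)) (∣n⇒∣m*n z k∣n) VA.∷ ∣ᵥ-*ᵥ k n b k∣n

  ∣ᵥ-+ᵥ : ∀ {d} k (u v : Point d) → k ∣ᵥ u → k ∣ᵥ v → k ∣ᵥ V.zipWith ℤ._+_ u v
  ∣ᵥ-+ᵥ k [] [] _ _ = VA.[]
  ∣ᵥ-+ᵥ k (x ∷ u) (y ∷ v) (k∣x VA.∷ k∣u) (k∣y VA.∷ k∣v) =
    ∣m∣n⇒∣m+n k∣x k∣y VA.∷ ∣ᵥ-+ᵥ k u v k∣u k∣v

  ∣ᵥ-+ᵥ⁻ : ∀ {d} k (u v : Point d) → k ∣ᵥ V.zipWith ℤ._+_ u v → k ∣ᵥ v → k ∣ᵥ u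
  ∣ᵥ-+ᵥ⁻ k [] [] _ _ = VA.[]
  ∣ᵥ-+ᵥ⁻ k (x ∷ u) (y ∷ v) (k∣x+y VA.∷ k∣u+v) (k∣y VA.∷ k∣v) =
    ∣m+n∣n⇒∣m k∣x+y k∣y VA.∷ ∣ᵥ-+ᵥ⁻ k u v k∣u+v k∣v

  ∣ᵥ⇒*ᵥ : ∀ {d} g (a : Point d) → + g ∣ᵥ a → Σ (Point d) λ w → a ≡ g *ᵥ w
  ∣ᵥ⇒*ᵥ g [] VA.[] = [] , refl
  ∣ᵥ⇒*ᵥ g (z ∷ a) (divides q z≡qg VA.∷ g∣a) =
    let (w , a≡gw) = ∣ᵥ⇒*ᵥ g a g∣a in q ∷ w , cong₂ _∷_ (trans z≡qg (ℤP.*-comm q (+ g))) a≡gw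

  *ᵥ⇒∣ᵥ : ∀ {d} g (w : Point d) → + g ∣ᵥ (g *ᵥ w)
  *ᵥ⇒∣ᵥ g [] = VA.[]
  *ᵥ⇒∣ᵥ g (q ∷ w) = divides q (ℤP.*-comm (+ g) q) VA.∷ *ᵥ⇒∣ᵥ g w

  module _ {d} (A : Matrix d) (det≡1 : det A ≡ + 1) where
    open Unimodular A det≡1 using (mulQ-integral)

    -- A (a / g) is a lattice point, hence so is a / g, because A⁻¹ is integral.
    ∣ᵥ-mulZ⁻ : ∀ g (a : Point d) → + suc g ∣ᵥ mulZ A a → + suc g ∣ᵥ a
    ∣ᵥ-mulZ⁻ g a g∣Aa = subst (+ suc g ∣ᵥ_) (sym a≡ga′) (*ᵥ⇒∣ᵥ (suc g) a′)
      where
      open Scaling g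
      w : Point d
      w = proj₁ (∣ᵥ⇒*ᵥ (suc g) (mulZ A a) g∣Aa)
      Aa≡gw : mulZ A a ≡ suc g *ᵥ w
      Aa≡gw = proj₂ (∣ᵥ⇒*ᵥ (suc g) (mulZ A a) g∣Aa)
      Ax≡w : mulQ A (k⁻¹ ·ᵥ embed a) ≡ embed w
      Ax≡w = begin
        mulQ A (k⁻¹ ·ᵥ embed a)         ≡⟨ mulQ-·ᵥ A k⁻¹ (embed a) ⟩
        k⁻¹ ·ᵥ mulQ A (embed a)         ≡⟨ cong (k⁻¹ ·ᵥ_) (embed-mulZ A a) ⟨
        k⁻¹ ·ᵥ embed (mulZ A a)         ≡⟨ cong (λ v → k⁻¹ ·ᵥ embed v) Aa≡gw ⟩
        k⁻¹ ·ᵥ embed (suc g *ᵥ w)       ≡⟨ cong (k⁻¹ ·ᵥ_) (embed-*ᵥ (suc g) w) ⟩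
        k⁻¹ ·ᵥ (k ·ᵥ embed w)           ≡⟨ y≡k·p⇒p≡k⁻¹·y (k ·ᵥ embed w) (embed w) refl ⟨
        embed w                         ∎
        where open ≡-Reasoning
      a′ : Point d
      a′ = proj₁ (mulQ-integral _ w Ax≡w)
      a≡ga′ : a ≡ suc g *ᵥ a′
      a≡ga′ = embed-injective a _ (begin
        embed a                         ≡⟨ k·k⁻¹·y≡y (embed a) ⟨
        k ·ᵥ (k⁻¹ ·ᵥ embed a)           ≡⟨ cong (k ·ᵥ_) (proj₂ (mulQ-integral _ w Ax≡w)) ⟩
        k ·ᵥ embed a′                   ≡⟨ embed-*ᵥ (suc g) a′ ⟨
        embed (suc g *ᵥ a′)             ∎)
        where open ≡-Reasoning

    ∣ᵥ-applyAff⇔ : ∀ g n b (a : Point d) → + suc g ∣ + n → + suc g ∣ᵥ applyAff A (n *ᵥ b) a ⇔ + suc g ∣ᵥ a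
    ∣ᵥ-applyAff⇔ g n b a g∣n = mk⇔
      (λ g∣fa → ∣ᵥ-mulZ⁻ g a (∣ᵥ-+ᵥ⁻ _ (mulZ A a) (n *ᵥ b) g∣fa (∣ᵥ-*ᵥ _ n b g∣n)))
      (λ g∣a → ∣ᵥ-+ᵥ _ (mulZ A a) (n *ᵥ b) (∣ᵥ-mulZ _ A a g∣a) (∣ᵥ-*ᵥ _ n b g∣n))

    gcdWith-applyAff : ∀ m b (a : Point d) → gcdWith (suc m) (applyAff A (suc m *ᵥ b) a) ≡ gcdWith (suc m) a
    gcdWith-applyAff m b a = same-divisors⇒≡ _ _ λ k → mk⇔
      (λ k∣G → let (k∣n , k∣fa) = to (∣gcdWith⇔ k n (applyAff A (n *ᵥ b) a)) k∣G in
        from (∣gcdWith⇔ k n a) (k∣n , transfer k k∣n k∣fa))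
      (λ k∣G → let (k∣n , k∣a) = to (∣gcdWith⇔ k n a) k∣G in
        from (∣gcdWith⇔ k n (applyAff A (n *ᵥ b) a)) (k∣n , transfer⁻ k k∣n k∣a))
      where
      n = suc m
      transfer : ∀ k → k ℕ∣.∣ n → + k ∣ᵥ applyAff A (n *ᵥ b) a → + k ∣ᵥ a
      transfer zero 0∣n _ = ⊥-elim (ℕP.0≢1+n (sym (ℕ∣.0∣⇒≡0 0∣n)))
      transfer (suc g) g∣n = to (∣ᵥ-applyAff⇔ g n b a (∣ᵤ⇒∣ g∣n))
      transfer⁻ : ∀ k → k ℕ∣.∣ n → + k ∣ᵥ a → + k ∣ᵥ applyAff A (n *ᵥ b) a
      transfer⁻ zero 0∣n _ = ⊥-elim (ℕP.0≢1+n (sym (ℕ∣.0∣⇒≡0 0∣n)))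
      transfer⁻ (suc g) g∣n = from (∣ᵥ-applyAff⇔ g n b a (∣ᵤ⇒∣ g∣n))


module Valuation where

  open import Defs
  open IntegerEmbedding using (embed-injective)
  open Finiteness using (InDilate⇔InPoly)
  open AffineImage
  open GcdInvariance using (gcdWith; gcdWith-applyAff)
  open import Data.Nat using (ℕ; suc; _+_)
  open import Data.Integer using (+_)
  import Data.Vec.Properties as VP
  import Data.Integer as ℤ
  open import Data.List as L using ([]; _∷_)
  import Data.List.Properties as LP
  open import Data.List.Relation.Unary.Any using (here)
  open import Data.List.Membership.Propositional using (_∈_)
  open import Data.List.Membership.Propositional.Properties using (∈-map⁺; ∈-map⁻)
  open import Data.List.Relation.Unary.Unique.Propositional.Properties using (map⁺)
  open import Data.Product using (Σ; _×_; _,_)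
  open import Data.Sum using (_⊎_; inj₁; inj₂; [_,_])
  import Data.Sum as Sum
  open import Data.Sum.Function.Propositional using (_⊎-⇔_)
  open import Data.Product.Function.NonDependent.Propositional using (_×-⇔_)
  open import Function.Bundles using (_⇔_; mk⇔; Equivalence)
  import Function.Properties.Equivalence as ⇔
  open import Relation.Binary.PropositionalEquality using (_≡_; refl; sym; trans; cong; subst)
  open Equivalence

  HasCE-empty : ∀ {d} n c → HasCE {d} [] n c → c ≡ 0
  HasCE-empty n c ([] , _ , len , _) = sym len
  HasCE-empty n c ((a ∷ _) , _ , _ , as≈) with to (as≈ a) (here refl)
  ... | (_ , ([] , _ , _ , () , _) , _) , _

  module _ (m : ℕ) where
    open Scaling m

    private
      n : ℕ
      n = suc m

    Counted : ∀ {d} → LatticePolytope d → Point d → Set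
    Counted P a = InDilate n P a × gcdCond n a

    Counted-∪ : ∀ {d} (P Q R : LatticePolytope d) → IsUnion R P Q → ∀ a → Counted R a ⇔ (Counted P a ⊎ Counted Q a)
    Counted-∪ P Q R R≈P∪Q a = mk⇔
      (λ (a∈nR , g) → Sum.map (_, g) (_, g) (to InDilate-∪ a∈nR))
      [ (λ (a∈nP , g) → from InDilate-∪ (inj₁ a∈nP) , g) , (λ (a∈nQ , g) → from InDilate-∪ (inj₂ a∈nQ) , g) ]
      where
      InDilate-∪ : InDilate n R a ⇔ (InDilate n P a ⊎ InDilate n Q a)
      InDilate-∪ = ⇔.trans (InDilate⇔InPoly m R a)
        (⇔.trans (R≈P∪Q _) (⇔.sym (InDilate⇔InPoly m P a ⊎-⇔ InDilate⇔InPoly m Q a)))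

    Counted-∩ : ∀ {d} (P Q S : LatticePolytope d) → IsInter S P Q → ∀ a → Counted S a ⇔ (Counted P a × Counted Q a)
    Counted-∩ P Q S S≈P∩Q a = mk⇔
      (λ (a∈nS , g) → let (a∈nP , a∈nQ) = to InDilate-∩ a∈nS in (a∈nP , g) , (a∈nQ , g))
      (λ ((a∈nP , g) , (a∈nQ , _)) → from InDilate-∩ (a∈nP , a∈nQ) , g)
      where
      InDilate-∩ : InDilate n S a ⇔ (InDilate n P a × InDilate n Q a)
      InDilate-∩ = ⇔.trans (InDilate⇔InPoly m S a)
        (⇔.trans (S≈P∩Q _) (⇔.sym (InDilate⇔InPoly m P a ×-⇔ InDilate⇔InPoly m Q a)))

    HasCE-modular : ∀ {d} (P Q R S : LatticePolytope d) → IsUnion R P Q → IsInter S P Q →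
      ∀ cP cQ cR cS → HasCE P n cP → HasCE Q n cQ → HasCE R n cR → HasCE S n cS → cR + cS ≡ cP + cQ
    HasCE-modular P Q R S R≈P∪Q S≈P∩Q _ _ _ _
      (xs , xs! , refl , xs≈) (ys , ys! , refl , ys≈) (zs , zs! , refl , zs≈) (ws , ws! , refl , ws≈) =
      Counting.length-∪+length-∩ (VP.≡-dec ℤ._≟_) xs ys zs ws xs! ys! zs! ws!
        (λ a → ⇔.trans (zs≈ a) (⇔.trans (Counted-∪ P Q R R≈P∪Q a) (⇔.sym (xs≈ a ⊎-⇔ ys≈ a))))
        (λ a → ⇔.trans (ws≈ a) (⇔.trans (Counted-∩ P Q S S≈P∩Q a) (⇔.sym (xs≈ a ×-⇔ ys≈ a))))

    module _ {d} (A : Matrix d) (b : Point d) (det≡1 : det A ≡ + 1) where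
      open UnimodularAffine A det≡1

      -- On nP the affine map x ↦ Ax + b becomes a ↦ Aa + nb.
      f : Point d → Point d
      f = applyAff A (n *ᵥ b)

      Counted-image : ∀ P a → Counted P a → Counted (imageP A b P) (f a)
      Counted-image P a ((p , p∈P , a≡kp) , g) =
        (affQ A b p , InPoly-image A b P p p∈P ,
          trans (embed-applyAff A (n *ᵥ b) a) (trans (cong (affQ A (n *ᵥ b)) a≡kp) (sym (·ᵥ-affQ A n b p)))) ,
        trans (gcdWith-applyAff A det≡1 m b a) g

      lattice-preimage : ∀ p a′ → embed a′ ≡ k ·ᵥ affQ A b p → Σ (Point d) λ a → embed a ≡ k ·ᵥ p × f a ≡ a′
      lattice-preimage p a′ a′≡kTp =
        let (a , kp≡a) = affQ-integral (n *ᵥ b) (k ·ᵥ p) a′ Ax+nb≡a′ in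
        a , sym kp≡a ,
        embed-injective (f a) a′ (trans (embed-applyAff A (n *ᵥ b) a) (trans (cong (affQ A (n *ᵥ b)) (sym kp≡a)) Ax+nb≡a′))
        where
        Ax+nb≡a′ : affQ A (n *ᵥ b) (k ·ᵥ p) ≡ embed a′
        Ax+nb≡a′ = trans (sym (·ᵥ-affQ A n b p)) (sym a′≡kTp)

      Counted-image⁻ : ∀ P a′ → Counted (imageP A b P) a′ → Σ (Point d) λ a → Counted P a × f a ≡ a′
      Counted-image⁻ P a′ ((q , q∈TP , a′≡kq) , g′) =
        let (p , p∈P , q≡Tp) = InPoly-image⁻ A b P q q∈TP
            (a , a≡kp , fa≡a′) = lattice-preimage p a′ (trans a′≡kq (cong (k ·ᵥ_) q≡Tp))
        in a , ((p , p∈P , a≡kp) , trans (sym (gcdWith-applyAff A det≡1 m b a)) (trans (cong (gcdWith n) fa≡a′) g′)) , fa≡a′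

      HasCE-image : ∀ (P : LatticePolytope d) c → HasCE P n c → HasCE (imageP A b P) n c
      HasCE-image P c (as , as! , len , as≈) =
        L.map f as , map⁺ (applyAff-injective (n *ᵥ b)) as! , trans (LP.length-map f as) len , λ a′ → mk⇔
          (λ a′∈fas → let (a , a∈as , a′≡fa) = ∈-map⁻ f a′∈fas in
            subst (Counted _) (sym a′≡fa) (Counted-image P a (to (as≈ a) a∈as)))
          (λ counted → let (a , counted-a , fa≡a′) = Counted-image⁻ P a′ counted in
            subst (_∈ L.map f as) fa≡a′ (∈-map⁺ f (from (as≈ a) counted-a)))


open import Defs
open import Data.Nat using (ℕ; suc; _+_; _≤_; s≤s; z≤n)
open import Data.Integer using (+_)
open import Data.List using ([])
open import Data.Product using (∃; _×_; _,_)
open import Relation.Binary.PropositionalEquality using (_≡_)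

lemma2p1 : (d n : ℕ) → 1 ≤ n →
    ((P : LatticePolytope d) → ∃ λ c → HasCE P n c)
    × (∀ c → HasCE {d} [] n c → c ≡ 0)
    × (∀ (P Q R S : LatticePolytope d) → IsUnion R P Q → IsInter S P Q →
    ∀ cP cQ cR cS → HasCE P n cP → HasCE Q n cQ → HasCE R n cR → HasCE S n cS →
    cR + cS ≡ cP + cQ)
    × (∀ (A : Matrix d) (b : Point d) → det A ≡ + 1 →
    ∀ (P : LatticePolytope d) c → HasCE P n c → HasCE (imageP A b P) n c)
lemma2p1 d (suc m) (s≤s z≤n) =
  Finiteness.HasCE-exists m ,
  Valuation.HasCE-empty (suc m) ,
  Valuation.HasCE-modular m ,
  Valuation.HasCE-image m
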